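{- Let $k\ge1$, let $\omega=(\omega_1,\ldots,\omega_k)$ be a rational weight vector and $q\in\mathbb{Q}$. Then the sequence $(H_{k,n,\omega}(t,q))_{n\ge0}$ is invertible for the level product, and its level-product inverse is $(H_{k,n,\omega}(t,-q))_{n\ge0}$; that is, $\sum_{i=0}^nH_{k,i,\omega}(t,q)H_{k,n-i,\omega}(t,-q)$ equals $1$ for $n=0$ and $0$ for $n\ge1$.
   Context: Let $t_1,\ldots,t_k$ be indeterminates, $t^\alpha=t_1^{\alpha_1}\cdots t_k^{\alpha_k}$ for $\alpha\in\mathbb{Z}_{\ge0}^k$, $|\alpha|=\sum_i\alpha_i$, $\alpha\vdash n$ means $\sum_i i\alpha_i=n$. For $q\in\mathbb{Q}$ and $j\ge0$ let $B^q_{ -(j)}=q(q-1)\cdots(q-j)$. The operators $D_j$ act on polynomials in indeterminates $\omega_1,\ldots,\omega_k$: $D_0=\mathrm{id}$, $D_1=\sum_i\partial/\partial\omega_i$, $D_j=D_1\circ D_{j-1}$; the resulting polynomial is evaluated at the given weight vector. Define $H_{k,0,\omega}(t,q)=1$ and, for $n\ge1$, $H_{k,n,\omega}(t,q)=\sum_{\alpha\vdash n}\Big(\sum_{j=0}^{|\alpha|-1}\frac{1}{\prod_i\alpha_i!}\binom{|\alpha|-1}{j}B^q_{ -(j)}D_{(|\alpha|-j-1)}(\omega_1^{\alpha_1}\cdots\omega_k^{\alpha_k})\Big)t^\alpha$. The level product of sequences is $(P*Q)_n=\sum_{i=0}^nP_iQ_{n-i}$, whose identity is the sequence $(1,0,0,\ldots)$.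 -}

module Defs where

open import Data.Nat as ℕ using (ℕ; zero; suc; _∸_; _!; NonZero)
open import Data.Nat.Properties using (_!≢0; m*n≢0)
open import Data.Nat.Combinatorics using (_C_)
open import Data.Integer using (+_)
open import Data.Rational using (ℚ; 0ℚ; 1ℚ; _+_; _*_; _-_; _/_)
open import Data.Vec using (Vec; []; _∷_)
open import Data.List using (List; []; _∷_; map; concatMap; upTo)
open import Data.Product using (_×_; _,_)
open import Data.Bool using (Bool; true; false; _∧_; if_then_else_)
open import Relation.Nullary.Decidable using (⌊_⌋)

ℕ→ℚ : ℕ → ℚ
ℕ→ℚ n = (+ n) / 1

_^ℚ_ : ℚ → ℕ → ℚ
p ^ℚ zero  = 1ℚ
p ^ℚ suc n = p * (p ^ℚ n)

sumℚ : List ℚ → ℚ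
sumℚ []       = 0ℚ
sumℚ (x ∷ xs) = x + sumℚ xs

prodℚ : List ℚ → ℚ
prodℚ []       = 1ℚ
prodℚ (x ∷ xs) = x * prodℚ xs

Σ<ℚ : ℕ → (ℕ → ℚ) → ℚ
Σ<ℚ n f = sumℚ (map f (upTo n))

size : ∀ {k} → Vec ℕ k → ℕ
size []       = 0
size (a ∷ as) = a ℕ.+ size as

-- Σ_i i·α_i  (indices i = 1..k);  α ⊢ n  iff  wdeg α ≡ n
wdeg′ : ∀ {k} → ℕ → Vec ℕ k → ℕ
wdeg′ i []       = 0
wdeg′ i (a ∷ as) = i ℕ.* a ℕ.+ wdeg′ (suc i) as

wdeg : ∀ {k} → Vec ℕ k → ℕ
wdeg = wdeg′ 1

isZero : ∀ {k} → Vec ℕ k → Bool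
isZero []       = true
isZero (a ∷ as) = ⌊ a ℕ.≟ 0 ⌋ ∧ isZero as

factProd : ∀ {k} → Vec ℕ k → ℕ
factProd []       = 1
factProd (a ∷ as) = (a !) ℕ.* factProd as

factProd≢0 : ∀ {k} (α : Vec ℕ k) → NonZero (factProd α)
factProd≢0 []       = _
factProd≢0 (a ∷ as) = m*n≢0 (a !) (factProd as) {{a !≢0}} {{factProd≢0 as}}

invFactProd : ∀ {k} → Vec ℕ k → ℚ
invFactProd α = _/_ (+ 1) (factProd α) {{factProd≢0 α}}

B : ℚ → ℕ → ℚ
B q j = prodℚ (map (λ m → q - ℕ→ℚ m) (upTo (suc j)))

-- Polynomials in ω_1..ω_k with rational coefficients, as finite lists of
-- terms (coefficient , exponent vector); the polynomial is their sum.

WPoly : ℕ → Set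
WPoly k = List (ℚ × Vec ℕ k)

monomial : ∀ {k} → Vec ℕ k → WPoly k
monomial e = (1ℚ , e) ∷ []

-- for a monomial with exponent vector e, the list over i of
-- (e_i , e with e_i replaced by e_i - 1), i.e. ∂/∂ω_i ω^e = e_i ω^{e - δ_i}
partials : ∀ {k} → Vec ℕ k → List (ℕ × Vec ℕ k)
partials []       = []
partials (a ∷ as) =
  (a , (a ∸ 1) ∷ as) ∷ map (λ { (m , e) → (m , a ∷ e) }) (partials as)

D₁ : ∀ {k} → WPoly k → WPoly k
D₁ p = concatMap (λ { (c , e) → map (λ { (m , e′) → (c * ℕ→ℚ m , e′) }) (partials e) }) p

D : ∀ {k} → ℕ → WPoly k → WPoly k
D zero    p = p
D (suc j) p = D₁ (D j p)

evalMono : ∀ {k} → Vec ℚ k → Vec ℕ k → ℚ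
evalMono []       []       = 1ℚ
evalMono (w ∷ ws) (a ∷ as) = (w ^ℚ a) * evalMono ws as

evalW : ∀ {k} → Vec ℚ k → WPoly k → ℚ
evalW ω p = sumℚ (map (λ { (c , e) → c * evalMono ω e }) p)

-- Polynomials in t_1..t_k with rational coefficients, represented by
-- their coefficient function α ↦ [t^α] P.

Poly : ℕ → Set
Poly k = Vec ℕ k → ℚ

zeroP : ∀ {k} → Poly k
zeroP _ = 0ℚ

oneP : ∀ {k} → Poly k
oneP α = if isZero α then 1ℚ else 0ℚ

_+P_ : ∀ {k} → Poly k → Poly k → Poly k
(f +P g) α = f α + g α

splits : ∀ {k} → Vec ℕ k → List (Vec ℕ k × Vec ℕ k)
splits []       = ([] , []) ∷ []
splits (g ∷ gs) =
  concatMap (λ a → map (λ { (x , y) → (a ∷ x , (g ∸ a) ∷ y) }) (splits gs))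
            (upTo (suc g))

_*P_ : ∀ {k} → Poly k → Poly k → Poly k
(f *P g) γ = sumℚ (map (λ { (α , β) → f α * g β }) (splits γ))

sumP : ∀ {k} → List (Poly k) → Poly k
sumP []       = zeroP
sumP (p ∷ ps) = p +P sumP ps

levelProd : ∀ {k} → (ℕ → Poly k) → (ℕ → Poly k) → ℕ → Poly k
levelProd P Q n = sumP (map (λ i → P i *P Q (n ∸ i)) (upTo (suc n)))

levelUnit : ∀ {k} → ℕ → Poly k
levelUnit zero    = oneP
levelUnit (suc n) = zeroP

Hterm : ∀ {k} → Vec ℚ k → ℚ → Vec ℕ k → ℚ
Hterm ω q α =
  Σ<ℚ (size α) (λ j →
    invFactProd α * ℕ→ℚ ((size α ∸ 1) C j) * B q j
      * evalW ω (D (size α ∸ j ∸ 1) (monomial α)))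

H : (k : ℕ) → Vec ℚ k → ℚ → ℕ → Poly k
H k ω q zero        = oneP
H k ω q n@(suc _) α = if ⌊ wdeg α ℕ.≟ n ⌋ then Hterm ω q α else 0ℚ

-- Summing H_{k,n,ω}(t,q) over all levels n gives a power series in t of which H_{k,n,ω} is the part of
-- weighted degree n, so the level product of the two sequences is the degree-n part of the ordinary
-- product of the two summed series, and it suffices to show that these series are mutually inverse.
-- With u = ω₁t₁ + ⋯ + ω_kt_k and v = t₁ + ⋯ + t_k, the series Σ_α ω^α t^α / α! is e^u and applying D_j
-- to it gives v^j e^u; summing over j with the weights C(|α|-1, j) B^q_{-(j)}, the summed series becomes
-- the exponential generating function Σ_{b,m} (q)_b b^(m) u^b v^m / (b! m!) = (1 + u/(1 - v))^q, where
-- (q)_b and b^(m) are falling and rising factorials. Products of such generating functions correspond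
-- to binomial convolutions of their coefficient arrays, and by Chu–Vandermonde for falling and rising
-- factorials the convolution of the arrays for q and -q is that of the constant 1.

module Submission where

open import Defs
open import Algebra.Bundles using (CommutativeMonoid)
import Algebra.Properties.CommutativeSemigroup as CommSemigroupProperties
open import Data.Bool using (true; false; if_then_else_)
import Data.Integer as ℤ
import Data.Integer.Tactic.RingSolver as ℤ-Solver
open import Data.List using (List; []; _∷_; _++_; map; concatMap; upTo; applyUpTo)
import Data.List.Properties as List
open import Data.List.Relation.Unary.All as All using (All; []; _∷_)
import Data.List.Relation.Unary.All.Properties as All
open import Data.Maybe.Base using (Maybe; just; nothing)
open import Data.Nat as ℕ using (ℕ; zero; suc; _∸_; _!; _≤_; NonZero)
open import Data.Nat.Combinatorics using (_C_; nCn≡1; nCk+nC[k+1]≡[n+1]C[k+1])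
open import Data.Nat.Coprimality as Coprime using (1-coprimeTo)
import Data.Nat.Properties as ℕ
import Data.Nat.Tactic.RingSolver as ℕ-Solver
open import Data.Product using (_×_; _,_; proj₁; proj₂; ∃-syntax)
open import Data.Rational using (ℚ; mkℚ; 0ℚ; 1ℚ; _+_; _*_; _-_; -_; _/_; toℚᵘ)
import Data.Rational.Properties as ℚ
import Data.Rational.Unnormalised as ℚᵘ
import Data.Rational.Unnormalised.Properties as ℚᵘ
open import Data.Vec using (Vec; []; _∷_)
open import Function using (_∘_; id)
open import Level using (0ℓ)
open import Relation.Binary.PropositionalEquality
open import Relation.Nullary using (yes; no; contradiction)
open import Tactic.RingSolver using (solve-∀)
open import Tactic.RingSolver.Core.AlmostCommutativeRing using (AlmostCommutativeRing; fromCommutativeRing)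
open ≡-Reasoning

module ℕ+ = CommSemigroupProperties ℕ.+-commutativeSemigroup
module ℕ* = CommSemigroupProperties ℕ.*-commutativeSemigroup
module ℚ+ = CommSemigroupProperties (CommutativeMonoid.commutativeSemigroup ℚ.+-0-commutativeMonoid)
module ℚ* = CommSemigroupProperties (CommutativeMonoid.commutativeSemigroup ℚ.*-1-commutativeMonoid)

ℚ-ring : AlmostCommutativeRing 0ℓ 0ℓ
ℚ-ring = fromCommutativeRing ℚ.+-*-commutativeRing isZero?
  where
  isZero? : (x : ℚ) → Maybe (0ℚ ≡ x)
  isZero? x with 0ℚ ℚ.≟ x
  ... | yes p = just p
  ... | no _  = nothing

ℕ→ℚ≡mkℚ : ∀ n → ℕ→ℚ n ≡ mkℚ (ℤ.+ n) 0 (Coprime.sym (1-coprimeTo n))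
ℕ→ℚ≡mkℚ n = ℚ.normalize-coprime (Coprime.sym (1-coprimeTo n))

ℕ→ℚ-suc : ∀ n → ℕ→ℚ (suc n) ≡ 1ℚ + ℕ→ℚ n
ℕ→ℚ-suc n = ℚ.toℚᵘ-injective (ℚᵘ.≃-trans unnormalised (ℚᵘ.≃-sym (ℚ.toℚᵘ-homo-+ 1ℚ (ℕ→ℚ n))))
  where
  unnormalised : toℚᵘ (ℕ→ℚ (suc n)) ℚᵘ.≃ toℚᵘ 1ℚ ℚᵘ.+ toℚᵘ (ℕ→ℚ n)
  unnormalised rewrite ℕ→ℚ≡mkℚ (suc n) | ℕ→ℚ≡mkℚ n = ℚᵘ.*≡* (cross (ℤ.+ n))
    where
    cross : ∀ x → (ℤ.+ 1 ℤ.+ x) ℤ.* (ℤ.+ 1 ℤ.* ℤ.+ 1) ≡ (ℤ.+ 1 ℤ.* ℤ.+ 1 ℤ.+ x ℤ.* ℤ.+ 1) ℤ.* ℤ.+ 1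
    cross = ℤ-Solver.solve-∀

ℕ→ℚ-+ : ∀ m n → ℕ→ℚ (m ℕ.+ n) ≡ ℕ→ℚ m + ℕ→ℚ n
ℕ→ℚ-+ zero    n = sym (ℚ.+-identityˡ (ℕ→ℚ n))
ℕ→ℚ-+ (suc m) n = begin
  ℕ→ℚ (suc (m ℕ.+ n))     ≡⟨ ℕ→ℚ-suc (m ℕ.+ n) ⟩
  1ℚ + ℕ→ℚ (m ℕ.+ n)      ≡⟨ cong (1ℚ +_) (ℕ→ℚ-+ m n) ⟩
  1ℚ + (ℕ→ℚ m + ℕ→ℚ n)    ≡⟨ ℚ.+-assoc 1ℚ (ℕ→ℚ m) (ℕ→ℚ n) ⟨
  (1ℚ + ℕ→ℚ m) + ℕ→ℚ n    ≡⟨ cong (_+ ℕ→ℚ n) (ℕ→ℚ-suc m) ⟨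
  ℕ→ℚ (suc m) + ℕ→ℚ n     ∎

ℕ→ℚ-* : ∀ m n → ℕ→ℚ (m ℕ.* n) ≡ ℕ→ℚ m * ℕ→ℚ n
ℕ→ℚ-* zero    n = sym (ℚ.*-zeroˡ (ℕ→ℚ n))
ℕ→ℚ-* (suc m) n = begin
  ℕ→ℚ (n ℕ.+ m ℕ.* n)       ≡⟨ ℕ→ℚ-+ n (m ℕ.* n) ⟩
  ℕ→ℚ n + ℕ→ℚ (m ℕ.* n)     ≡⟨ cong (ℕ→ℚ n +_) (ℕ→ℚ-* m n) ⟩
  ℕ→ℚ n + ℕ→ℚ m * ℕ→ℚ n     ≡⟨ distrib (ℕ→ℚ n) (ℕ→ℚ m) ⟩
  (1ℚ + ℕ→ℚ m) * ℕ→ℚ n      ≡⟨ cong (_* ℕ→ℚ n) (ℕ→ℚ-suc m) ⟨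
  ℕ→ℚ (suc m) * ℕ→ℚ n       ∎
  where
  distrib : ∀ a b → a + b * a ≡ (1ℚ + b) * a
  distrib = solve-∀ ℚ-ring

recip : (n : ℕ) → .{{NonZero n}} → ℚ
recip n = ℤ.+ 1 / n

ℕ→ℚ-*-recip : ∀ n .{{_ : NonZero n}} → ℕ→ℚ n * recip n ≡ 1ℚ
ℕ→ℚ-*-recip (suc n) rewrite ℕ→ℚ≡mkℚ (suc n) | ℚ.normalize-coprime {1} {n} (1-coprimeTo (suc n)) =
  ℚ.*-inverseʳ (mkℚ (ℤ.+ suc n) 0 (Coprime.sym (1-coprimeTo (suc n))))

ℕ→ℚ-*-cancelˡ : ∀ n .{{_ : NonZero n}} {x y} → ℕ→ℚ n * x ≡ ℕ→ℚ n * y → x ≡ y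
ℕ→ℚ-*-cancelˡ n {x} {y} nx≡ny = begin
  x                         ≡⟨ ℚ.*-identityˡ x ⟨
  1ℚ * x                    ≡⟨ cong (_* x) recip-*-ℕ→ℚ ⟨
  (recip n * ℕ→ℚ n) * x     ≡⟨ ℚ.*-assoc (recip n) (ℕ→ℚ n) x ⟩
  recip n * (ℕ→ℚ n * x)     ≡⟨ cong (recip n *_) nx≡ny ⟩
  recip n * (ℕ→ℚ n * y)     ≡⟨ ℚ.*-assoc (recip n) (ℕ→ℚ n) y ⟨
  (recip n * ℕ→ℚ n) * y     ≡⟨ cong (_* y) recip-*-ℕ→ℚ ⟩
  1ℚ * y                    ≡⟨ ℚ.*-identityˡ y ⟩
  y                         ∎
  where
  recip-*-ℕ→ℚ : recip n * ℕ→ℚ n ≡ 1ℚ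
  recip-*-ℕ→ℚ = trans (ℚ.*-comm (recip n) (ℕ→ℚ n)) (ℕ→ℚ-*-recip n)

recip-* : ∀ m n .{{_ : NonZero m}} .{{_ : NonZero n}} →
          recip (m ℕ.* n) {{ℕ.m*n≢0 m n}} ≡ recip m * recip n
recip-* m n = ℕ→ℚ-*-cancelˡ (m ℕ.* n) {{ℕ.m*n≢0 m n}} (begin
  ℕ→ℚ (m ℕ.* n) * recip (m ℕ.* n) {{ℕ.m*n≢0 m n}}  ≡⟨ ℕ→ℚ-*-recip (m ℕ.* n) {{ℕ.m*n≢0 m n}} ⟩
  1ℚ                                                  ≡⟨ cong₂ _*_ (ℕ→ℚ-*-recip m) (ℕ→ℚ-*-recip n) ⟨
  (ℕ→ℚ m * recip m) * (ℕ→ℚ n * recip n)             ≡⟨ ℚ*.interchange (ℕ→ℚ m) (recip m) (ℕ→ℚ n) (recip n) ⟩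
  (ℕ→ℚ m * ℕ→ℚ n) * (recip m * recip n)             ≡⟨ cong (_* (recip m * recip n)) (ℕ→ℚ-* m n) ⟨
  ℕ→ℚ (m ℕ.* n) * (recip m * recip n)               ∎)

binom : ℕ → ℕ → ℕ
binom zero    j       = 1
binom (suc i) zero    = 1
binom (suc i) (suc j) = binom i (suc j) ℕ.+ binom (suc i) j

binomℚ : ℕ → ℕ → ℚ
binomℚ i j = ℕ→ℚ (binom i j)

C≡binom : ∀ a b → (a ℕ.+ b) C a ≡ binom a b
C≡binom zero    b       = refl
C≡binom (suc a) zero    = trans (cong (_C suc a) (ℕ.+-identityʳ (suc a))) (nCn≡1 (suc a))
C≡binom (suc a) (suc b) = begin
  suc (a ℕ.+ suc b) C suc a
    ≡⟨ nCk+nC[k+1]≡[n+1]C[k+1] (a ℕ.+ suc b) a ⟨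
  (a ℕ.+ suc b) C a ℕ.+ (a ℕ.+ suc b) C suc a
    ≡⟨ cong₂ ℕ._+_ (C≡binom a (suc b)) (trans (cong (_C suc a) (ℕ.+-suc a b)) (C≡binom (suc a) b)) ⟩
  binom a (suc b) ℕ.+ binom (suc a) b ∎

binom-! : ∀ a b → binom a b ℕ.* (a ! ℕ.* b !) ≡ (a ℕ.+ b) !
binom-! zero    b       = trans (ℕ.*-identityˡ (1 ℕ.* b !)) (ℕ.*-identityˡ (b !))
binom-! (suc a) zero    = trans (trans (ℕ.+-identityʳ _) (ℕ.*-identityʳ (suc a !))) (cong _! (sym (ℕ.+-identityʳ (suc a))))
binom-! (suc a) (suc b) = begin
  (X ℕ.+ Y) ℕ.* ((suc a ℕ.* a !) ℕ.* (suc b ℕ.* b !))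
    ≡⟨ split X Y a b (a !) (b !) ⟩
  suc a ℕ.* (X ℕ.* (a ! ℕ.* (suc b ℕ.* b !))) ℕ.+ suc b ℕ.* (Y ℕ.* ((suc a ℕ.* a !) ℕ.* b !))
    ≡⟨ cong₂ (λ u v → suc a ℕ.* u ℕ.+ suc b ℕ.* v) (trans (binom-! a (suc b)) (cong _! (ℕ.+-suc a b))) (binom-! (suc a) b) ⟩
  suc a ℕ.* P ℕ.+ suc b ℕ.* P
    ≡⟨ ℕ.*-distribʳ-+ P (suc a) (suc b) ⟨
  (suc a ℕ.+ suc b) ℕ.* P
    ≡⟨ cong (λ z → suc (a ℕ.+ suc b) ℕ.* z !) (ℕ.+-suc a b) ⟨
  (suc a ℕ.+ suc b) !
    ∎
  where
  X Y P : ℕ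
  X = binom a (suc b)
  Y = binom (suc a) b
  P = (suc (a ℕ.+ b)) !
  split : ∀ X Y a b fa fb → (X ℕ.+ Y) ℕ.* ((suc a ℕ.* fa) ℕ.* (suc b ℕ.* fb)) ≡
          suc a ℕ.* (X ℕ.* (fa ℕ.* (suc b ℕ.* fb))) ℕ.+ suc b ℕ.* (Y ℕ.* ((suc a ℕ.* fa) ℕ.* fb))
  split = ℕ-Solver.solve-∀

invFact : ℕ → ℚ
invFact n = recip (n !) {{n ℕ.!≢0}}

ℕ→ℚ-!-*-invFact : ∀ n → ℕ→ℚ (n !) * invFact n ≡ 1ℚ
ℕ→ℚ-!-*-invFact n = ℕ→ℚ-*-recip (n !) {{n ℕ.!≢0}}

invFact-suc : ∀ n → invFact (suc n) * ℕ→ℚ (suc n) ≡ invFact n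
invFact-suc n = begin
  invFact (suc n) * ℕ→ℚ (suc n)            ≡⟨ cong (_* ℕ→ℚ (suc n)) (recip-* (suc n) (n !) {{_}} {{n ℕ.!≢0}}) ⟩
  (recip (suc n) * invFact n) * ℕ→ℚ (suc n) ≡⟨ ℚ*.xy∙z≈zx∙y (recip (suc n)) (invFact n) (ℕ→ℚ (suc n)) ⟩
  (ℕ→ℚ (suc n) * recip (suc n)) * invFact n ≡⟨ cong (_* invFact n) (ℕ→ℚ-*-recip (suc n)) ⟩
  1ℚ * invFact n                            ≡⟨ ℚ.*-identityˡ (invFact n) ⟩
  invFact n                                 ∎

invFact-* : ∀ a b → invFact a * invFact b ≡ invFact (a ℕ.+ b) * binomℚ a b
invFact-* a b = ℕ→ℚ-*-cancelˡ ((a ℕ.+ b) !) {{(a ℕ.+ b) ℕ.!≢0}} (begin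
  ℕ→ℚ ((a ℕ.+ b) !) * (invFact a * invFact b)
    ≡⟨ cong (λ z → ℕ→ℚ z * (invFact a * invFact b)) (binom-! a b) ⟨
  ℕ→ℚ (binom a b ℕ.* (a ! ℕ.* b !)) * (invFact a * invFact b)
    ≡⟨ cong (_* (invFact a * invFact b)) (trans (ℕ→ℚ-* (binom a b) (a ! ℕ.* b !)) (cong (binomℚ a b *_) (ℕ→ℚ-* (a !) (b !)))) ⟩
  (binomℚ a b * (ℕ→ℚ (a !) * ℕ→ℚ (b !))) * (invFact a * invFact b)
    ≡⟨ regroup (binomℚ a b) (ℕ→ℚ (a !)) (ℕ→ℚ (b !)) (invFact a) (invFact b) ⟩
  binomℚ a b * ((ℕ→ℚ (a !) * invFact a) * (ℕ→ℚ (b !) * invFact b))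
    ≡⟨ cong₂ (λ u v → binomℚ a b * (u * v)) (ℕ→ℚ-!-*-invFact a) (ℕ→ℚ-!-*-invFact b) ⟩
  binomℚ a b * (1ℚ * 1ℚ)
    ≡⟨ ℚ.*-identityʳ (binomℚ a b) ⟩
  binomℚ a b
    ≡⟨ ℚ.*-identityˡ (binomℚ a b) ⟨
  1ℚ * binomℚ a b
    ≡⟨ cong (_* binomℚ a b) (ℕ→ℚ-!-*-invFact (a ℕ.+ b)) ⟨
  (ℕ→ℚ ((a ℕ.+ b) !) * invFact (a ℕ.+ b)) * binomℚ a b
    ≡⟨ ℚ.*-assoc (ℕ→ℚ ((a ℕ.+ b) !)) (invFact (a ℕ.+ b)) (binomℚ a b) ⟩
  ℕ→ℚ ((a ℕ.+ b) !) * (invFact (a ℕ.+ b) * binomℚ a b) ∎)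
  where
  regroup : ∀ c p q x y → (c * (p * q)) * (x * y) ≡ c * ((p * x) * (q * y))
  regroup = solve-∀ ℚ-ring

invFactProd-∷ : ∀ {k} a (α : Vec ℕ k) → invFactProd (a ∷ α) ≡ invFact a * invFactProd α
invFactProd-∷ a α = recip-* (a !) (factProd α) {{a ℕ.!≢0}} {{factProd≢0 α}}

Σ₊ : ℕ → (ℕ → ℕ → ℚ) → ℚ
Σ₊ zero    Φ = Φ 0 0
Σ₊ (suc n) Φ = Φ 0 (suc n) + Σ₊ n (λ i j → Φ (suc i) j)

Σ₊-cong : ∀ n {Φ Ψ} → (∀ i j → Φ i j ≡ Ψ i j) → Σ₊ n Φ ≡ Σ₊ n Ψ
Σ₊-cong zero    Φ≡Ψ = Φ≡Ψ 0 0
Σ₊-cong (suc n) Φ≡Ψ = cong₂ _+_ (Φ≡Ψ 0 (suc n)) (Σ₊-cong n (λ i j → Φ≡Ψ (suc i) j))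

Σ₊-cong-on : ∀ n {Φ Ψ} → (∀ i j → i ℕ.+ j ≡ n → Φ i j ≡ Ψ i j) → Σ₊ n Φ ≡ Σ₊ n Ψ
Σ₊-cong-on zero    Φ≡Ψ = Φ≡Ψ 0 0 refl
Σ₊-cong-on (suc n) Φ≡Ψ = cong₂ _+_ (Φ≡Ψ 0 (suc n) refl) (Σ₊-cong-on n (λ i j p → Φ≡Ψ (suc i) j (cong suc p)))

Σ₊-zero : ∀ n {Φ} → (∀ i j → i ℕ.+ j ≡ n → Φ i j ≡ 0ℚ) → Σ₊ n Φ ≡ 0ℚ
Σ₊-zero zero    Φ≡0 = Φ≡0 0 0 refl
Σ₊-zero (suc n) Φ≡0 =
  trans (cong₂ _+_ (Φ≡0 0 (suc n) refl) (Σ₊-zero n (λ i j p → Φ≡0 (suc i) j (cong suc p)))) (ℚ.+-identityˡ 0ℚ)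

Σ₊-+ : ∀ n Φ Ψ → Σ₊ n (λ i j → Φ i j + Ψ i j) ≡ Σ₊ n Φ + Σ₊ n Ψ
Σ₊-+ zero    Φ Ψ = refl
Σ₊-+ (suc n) Φ Ψ = begin
  (Φ 0 (suc n) + Ψ 0 (suc n)) + Σ₊ n (λ i j → Φ (suc i) j + Ψ (suc i) j)
    ≡⟨ cong ((Φ 0 (suc n) + Ψ 0 (suc n)) +_) (Σ₊-+ n (λ i j → Φ (suc i) j) (λ i j → Ψ (suc i) j)) ⟩
  (Φ 0 (suc n) + Ψ 0 (suc n)) + (Σ₊ n (λ i j → Φ (suc i) j) + Σ₊ n (λ i j → Ψ (suc i) j))
    ≡⟨ ℚ+.interchange (Φ 0 (suc n)) (Ψ 0 (suc n)) _ _ ⟩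
  Σ₊ (suc n) Φ + Σ₊ (suc n) Ψ ∎

Σ₊-*ˡ : ∀ n c Φ → Σ₊ n (λ i j → c * Φ i j) ≡ c * Σ₊ n Φ
Σ₊-*ˡ zero    c Φ = refl
Σ₊-*ˡ (suc n) c Φ = begin
  c * Φ 0 (suc n) + Σ₊ n (λ i j → c * Φ (suc i) j)   ≡⟨ cong (c * Φ 0 (suc n) +_) (Σ₊-*ˡ n c (λ i j → Φ (suc i) j)) ⟩
  c * Φ 0 (suc n) + c * Σ₊ n (λ i j → Φ (suc i) j)   ≡⟨ ℚ.*-distribˡ-+ c (Φ 0 (suc n)) _ ⟨
  c * Σ₊ (suc n) Φ                                    ∎

Σ₊-*ʳ : ∀ n c Φ → Σ₊ n (λ i j → Φ i j * c) ≡ Σ₊ n Φ * c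
Σ₊-*ʳ n c Φ = begin
  Σ₊ n (λ i j → Φ i j * c)   ≡⟨ Σ₊-cong n (λ i j → ℚ.*-comm (Φ i j) c) ⟩
  Σ₊ n (λ i j → c * Φ i j)   ≡⟨ Σ₊-*ˡ n c Φ ⟩
  c * Σ₊ n Φ                 ≡⟨ ℚ.*-comm c (Σ₊ n Φ) ⟩
  Σ₊ n Φ * c                 ∎

Σ₊-sucʳ : ∀ n Φ → Σ₊ (suc n) Φ ≡ Σ₊ n (λ i j → Φ i (suc j)) + Φ (suc n) 0
Σ₊-sucʳ zero    Φ = refl
Σ₊-sucʳ (suc n) Φ = begin
  Φ 0 (suc (suc n)) + Σ₊ (suc n) (λ i j → Φ (suc i) j)
    ≡⟨ cong (Φ 0 (suc (suc n)) +_) (Σ₊-sucʳ n (λ i j → Φ (suc i) j)) ⟩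
  Φ 0 (suc (suc n)) + (Σ₊ n (λ i j → Φ (suc i) (suc j)) + Φ (suc (suc n)) 0)
    ≡⟨ ℚ.+-assoc (Φ 0 (suc (suc n))) _ _ ⟨
  Σ₊ (suc n) (λ i j → Φ i (suc j)) + Φ (suc (suc n)) 0 ∎

Σ₊-comm : ∀ n Φ → Σ₊ n Φ ≡ Σ₊ n (λ i j → Φ j i)
Σ₊-comm zero    Φ = refl
Σ₊-comm (suc n) Φ = begin
  Φ 0 (suc n) + Σ₊ n (λ i j → Φ (suc i) j)   ≡⟨ cong (Φ 0 (suc n) +_) (Σ₊-comm n (λ i j → Φ (suc i) j)) ⟩
  Φ 0 (suc n) + Σ₊ n (λ i j → Φ (suc j) i)   ≡⟨ ℚ.+-comm (Φ 0 (suc n)) _ ⟩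
  Σ₊ n (λ i j → Φ (suc j) i) + Φ 0 (suc n)   ≡⟨ Σ₊-sucʳ n (λ i j → Φ j i) ⟨
  Σ₊ (suc n) (λ i j → Φ j i)                 ∎

Σ₊-assoc : ∀ n (Φ : ℕ → ℕ → ℕ → ℚ) →
           Σ₊ n (λ i j → Σ₊ j (λ k l → Φ i k l)) ≡ Σ₊ n (λ m l → Σ₊ m (λ i k → Φ i k l))
Σ₊-assoc zero    Φ = refl
Σ₊-assoc (suc n) Φ = begin
  Σ₊ (suc n) (λ k l → Φ 0 k l) + Σ₊ n (λ i j → Σ₊ j (λ k l → Φ (suc i) k l))
    ≡⟨ cong (Σ₊ (suc n) (λ k l → Φ 0 k l) +_) (Σ₊-assoc n (λ i k l → Φ (suc i) k l)) ⟩
  (Φ 0 0 (suc n) + Σ₊ n (λ k l → Φ 0 (suc k) l)) + Σ₊ n (λ m l → Σ₊ m (λ i k → Φ (suc i) k l))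
    ≡⟨ ℚ.+-assoc (Φ 0 0 (suc n)) _ _ ⟩
  Φ 0 0 (suc n) + (Σ₊ n (λ k l → Φ 0 (suc k) l) + Σ₊ n (λ m l → Σ₊ m (λ i k → Φ (suc i) k l)))
    ≡⟨ cong (Φ 0 0 (suc n) +_) (Σ₊-+ n (λ m l → Φ 0 (suc m) l) (λ m l → Σ₊ m (λ i k → Φ (suc i) k l))) ⟨
  Σ₊ (suc n) (λ m l → Σ₊ m (λ i k → Φ i k l)) ∎

Σ₊-Σ₊-comm : ∀ n m (Φ : ℕ → ℕ → ℕ → ℕ → ℚ) →
             Σ₊ n (λ i j → Σ₊ m (λ k l → Φ i j k l)) ≡ Σ₊ m (λ k l → Σ₊ n (λ i j → Φ i j k l))
Σ₊-Σ₊-comm zero    m Φ = refl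
Σ₊-Σ₊-comm (suc n) m Φ = begin
  Σ₊ m (λ k l → Φ 0 (suc n) k l) + Σ₊ n (λ i j → Σ₊ m (λ k l → Φ (suc i) j k l))
    ≡⟨ cong (Σ₊ m (λ k l → Φ 0 (suc n) k l) +_) (Σ₊-Σ₊-comm n m (λ i j → Φ (suc i) j)) ⟩
  Σ₊ m (λ k l → Φ 0 (suc n) k l) + Σ₊ m (λ k l → Σ₊ n (λ i j → Φ (suc i) j k l))
    ≡⟨ Σ₊-+ m (λ k l → Φ 0 (suc n) k l) (λ k l → Σ₊ n (λ i j → Φ (suc i) j k l)) ⟨
  Σ₊ m (λ k l → Σ₊ (suc n) (λ i j → Φ i j k l)) ∎

Σ₊-last : ∀ n Φ → (∀ i j → Φ i (suc j) ≡ 0ℚ) → Σ₊ n Φ ≡ Φ n 0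
Σ₊-last zero    Φ Φ≡0 = refl
Σ₊-last (suc n) Φ Φ≡0 = begin
  Σ₊ (suc n) Φ                                ≡⟨ Σ₊-sucʳ n Φ ⟩
  Σ₊ n (λ i j → Φ i (suc j)) + Φ (suc n) 0    ≡⟨ cong (_+ Φ (suc n) 0) (Σ₊-zero n (λ i j _ → Φ≡0 i j)) ⟩
  0ℚ + Φ (suc n) 0                            ≡⟨ ℚ.+-identityˡ (Φ (suc n) 0) ⟩
  Φ (suc n) 0                                 ∎

Σ₊-single : ∀ b m Φ → (∀ i j → i ℕ.+ j ≡ b ℕ.+ m → j ≢ m → Φ i j ≡ 0ℚ) → Σ₊ (b ℕ.+ m) Φ ≡ Φ b m
Σ₊-single zero    zero    Φ Φ≡0 = refl
Σ₊-single zero    (suc m) Φ Φ≡0 = begin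
  Φ 0 (suc m) + Σ₊ m (λ i j → Φ (suc i) j)
    ≡⟨ cong (Φ 0 (suc m) +_) (Σ₊-zero m (λ i j p → Φ≡0 (suc i) j (cong suc p) (j≢ i j p))) ⟩
  Φ 0 (suc m) + 0ℚ
    ≡⟨ ℚ.+-identityʳ (Φ 0 (suc m)) ⟩
  Φ 0 (suc m) ∎
  where
  j≢ : ∀ i j → i ℕ.+ j ≡ m → j ≢ suc m
  j≢ i j p j≡ = ℕ.m≢1+n+m j (trans j≡ (cong suc (sym p)))
Σ₊-single (suc b) m Φ Φ≡0 = begin
  Φ 0 (suc (b ℕ.+ m)) + Σ₊ (b ℕ.+ m) (λ i j → Φ (suc i) j)
    ≡⟨ cong₂ _+_ (Φ≡0 0 (suc (b ℕ.+ m)) refl (≢-sym (ℕ.m≢1+n+m m)))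
                 (Σ₊-single b m (λ i j → Φ (suc i) j) (λ i j p → Φ≡0 (suc i) j (cong suc p))) ⟩
  0ℚ + Φ (suc b) m
    ≡⟨ ℚ.+-identityˡ (Φ (suc b) m) ⟩
  Φ (suc b) m ∎

Σbin : ℕ → (ℕ → ℕ → ℚ) → ℚ
Σbin n Ψ = Σ₊ n (λ i j → binomℚ i j * Ψ i j)

Σbin-cong : ∀ n {Φ Ψ} → (∀ i j → Φ i j ≡ Ψ i j) → Σbin n Φ ≡ Σbin n Ψ
Σbin-cong n Φ≡Ψ = Σ₊-cong n (λ i j → cong (binomℚ i j *_) (Φ≡Ψ i j))

Σbin-cong-on : ∀ n {Φ Ψ} → (∀ i j → i ℕ.+ j ≡ n → Φ i j ≡ Ψ i j) → Σbin n Φ ≡ Σbin n Ψ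
Σbin-cong-on n Φ≡Ψ = Σ₊-cong-on n (λ i j p → cong (binomℚ i j *_) (Φ≡Ψ i j p))

Σbin-*ˡ : ∀ n c Φ → Σbin n (λ i j → c * Φ i j) ≡ c * Σbin n Φ
Σbin-*ˡ n c Φ = trans (Σ₊-cong n (λ i j → ℚ*.x∙yz≈y∙xz (binomℚ i j) c (Φ i j))) (Σ₊-*ˡ n c (λ i j → binomℚ i j * Φ i j))

Σbin-*ʳ : ∀ n c Φ → Σbin n (λ i j → Φ i j * c) ≡ Σbin n Φ * c
Σbin-*ʳ n c Φ = trans (Σ₊-cong n (λ i j → sym (ℚ.*-assoc (binomℚ i j) (Φ i j) c))) (Σ₊-*ʳ n c (λ i j → binomℚ i j * Φ i j))

Σbin-comm : ∀ n m (Φ : ℕ → ℕ → ℕ → ℕ → ℚ) →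
            Σbin n (λ i j → Σbin m (λ k l → Φ i j k l)) ≡ Σbin m (λ k l → Σbin n (λ i j → Φ i j k l))
Σbin-comm n m Φ = begin
  Σ₊ n (λ i j → binomℚ i j * Σ₊ m (λ k l → binomℚ k l * Φ i j k l))
    ≡⟨ Σ₊-cong n (λ i j → Σ₊-*ˡ m (binomℚ i j) (λ k l → binomℚ k l * Φ i j k l)) ⟨
  Σ₊ n (λ i j → Σ₊ m (λ k l → binomℚ i j * (binomℚ k l * Φ i j k l)))
    ≡⟨ Σ₊-Σ₊-comm n m (λ i j k l → binomℚ i j * (binomℚ k l * Φ i j k l)) ⟩
  Σ₊ m (λ k l → Σ₊ n (λ i j → binomℚ i j * (binomℚ k l * Φ i j k l)))
    ≡⟨ Σ₊-cong m (λ k l → trans (Σ₊-cong n (λ i j → ℚ*.x∙yz≈y∙xz (binomℚ i j) (binomℚ k l) (Φ i j k l)))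
                                (Σ₊-*ˡ n (binomℚ k l) (λ i j → binomℚ i j * Φ i j k l))) ⟩
  Σ₊ m (λ k l → binomℚ k l * Σ₊ n (λ i j → binomℚ i j * Φ i j k l)) ∎

Σbin-suc : ∀ n Ψ → Σbin (suc n) Ψ ≡ Σbin n (λ i j → Ψ (suc i) j) + Σbin n (λ i j → Ψ i (suc j))
Σbin-suc zero    Ψ = ℚ.+-comm (1ℚ * Ψ 0 1) (1ℚ * Ψ 1 0)
Σbin-suc (suc n) Ψ = begin
  a + Σ₊ (suc n) (λ i j → binomℚ (suc i) j * Ψ (suc i) j)
    ≡⟨ cong (a +_) (Σ₊-sucʳ n (λ i j → binomℚ (suc i) j * Ψ (suc i) j)) ⟩
  a + (Σ₊ n (λ i j → binomℚ (suc i) (suc j) * Ψ (suc i) (suc j)) + b)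
    ≡⟨ cong (λ z → a + (z + b)) (Σ₊-cong n pascal) ⟩
  a + (Σ₊ n (λ i j → X i j + Y i j) + b)
    ≡⟨ cong (λ z → a + (z + b)) (Σ₊-+ n X Y) ⟩
  a + ((Σ₊ n X + Σ₊ n Y) + b)
    ≡⟨ shuffle a (Σ₊ n X) (Σ₊ n Y) b ⟩
  (Σ₊ n X + b) + (a + Σ₊ n Y)
    ≡⟨ cong (_+ (a + Σ₊ n Y)) (Σ₊-sucʳ n (λ i j → binomℚ i j * Ψ (suc i) j)) ⟨
  Σbin (suc n) (λ i j → Ψ (suc i) j) + Σbin (suc n) (λ i j → Ψ i (suc j)) ∎
  where
  a b : ℚ
  a = binomℚ 0 (suc (suc n)) * Ψ 0 (suc (suc n))
  b = binomℚ (suc (suc n)) 0 * Ψ (suc (suc n)) 0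
  X Y : ℕ → ℕ → ℚ
  X i j = binomℚ i (suc j) * Ψ (suc i) (suc j)
  Y i j = binomℚ (suc i) j * Ψ (suc i) (suc j)
  pascal : ∀ i j → binomℚ (suc i) (suc j) * Ψ (suc i) (suc j) ≡ X i j + Y i j
  pascal i j = trans (cong (_* Ψ (suc i) (suc j)) (ℕ→ℚ-+ (binom i (suc j)) (binom (suc i) j)))
                     (ℚ.*-distribʳ-+ (Ψ (suc i) (suc j)) (binomℚ i (suc j)) (binomℚ (suc i) j))
  shuffle : ∀ a x y b → a + ((x + y) + b) ≡ (x + b) + (a + y)
  shuffle = solve-∀ ℚ-ring

Σbin-split : ∀ A x Ψ → Σbin (A ℕ.+ x) Ψ ≡ Σbin A (λ a b → Σbin x (λ x₁ x₂ → Ψ (a ℕ.+ x₁) (b ℕ.+ x₂)))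
Σbin-split zero    x Ψ = sym (ℚ.*-identityˡ (Σbin x Ψ))
Σbin-split (suc A) x Ψ = begin
  Σbin (suc (A ℕ.+ x)) Ψ
    ≡⟨ Σbin-suc (A ℕ.+ x) Ψ ⟩
  Σbin (A ℕ.+ x) (λ i j → Ψ (suc i) j) + Σbin (A ℕ.+ x) (λ i j → Ψ i (suc j))
    ≡⟨ cong₂ _+_ (Σbin-split A x (λ i j → Ψ (suc i) j)) (Σbin-split A x (λ i j → Ψ i (suc j))) ⟩
  Σbin A (λ a b → Σbin x (λ x₁ x₂ → Ψ (suc a ℕ.+ x₁) (b ℕ.+ x₂))) + Σbin A (λ a b → Σbin x (λ x₁ x₂ → Ψ (a ℕ.+ x₁) (suc b ℕ.+ x₂)))
    ≡⟨ Σbin-suc A (λ a b → Σbin x (λ x₁ x₂ → Ψ (a ℕ.+ x₁) (b ℕ.+ x₂))) ⟨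
  Σbin (suc A) (λ a b → Σbin x (λ x₁ x₂ → Ψ (a ℕ.+ x₁) (b ℕ.+ x₂))) ∎

pochhammer : ℚ → ℚ → ℕ → ℚ
pochhammer d x zero    = 1ℚ
pochhammer d x (suc n) = x * pochhammer d (x + d) n

pochhammer-vandermonde : ∀ d n x y → pochhammer d (x + y) n ≡ Σbin n (λ i j → pochhammer d x i * pochhammer d y j)
pochhammer-vandermonde d zero    x y = refl
pochhammer-vandermonde d (suc n) x y = begin
  (x + y) * P (x + y + d) n
    ≡⟨ ℚ.*-distribʳ-+ (P (x + y + d) n) x y ⟩
  x * P (x + y + d) n + y * P (x + y + d) n
    ≡⟨ cong₂ (λ u v → x * P u n + y * P v n) (ℚ+.xy∙z≈xz∙y x y d) (ℚ.+-assoc x y d) ⟩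
  x * P (x + d + y) n + y * P (x + (y + d)) n
    ≡⟨ cong₂ _+_ (cong (x *_) (pochhammer-vandermonde d n (x + d) y)) (cong (y *_) (pochhammer-vandermonde d n x (y + d))) ⟩
  x * Σbin n (λ i j → P (x + d) i * P y j) + y * Σbin n (λ i j → P x i * P (y + d) j)
    ≡⟨ cong₂ _+_ (Σbin-*ˡ n x _) (Σbin-*ˡ n y _) ⟨
  Σbin n (λ i j → x * (P (x + d) i * P y j)) + Σbin n (λ i j → y * (P x i * P (y + d) j))
    ≡⟨ cong₂ _+_ (Σbin-cong n (λ i j → sym (ℚ.*-assoc x _ _)))
                 (Σbin-cong n (λ i j → ℚ*.x∙yz≈y∙xz y (P x i) _)) ⟩
  Σbin n (λ i j → P x (suc i) * P y j) + Σbin n (λ i j → P x i * P y (suc j))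
    ≡⟨ Σbin-suc n (λ i j → P x i * P y j) ⟨
  Σbin (suc n) (λ i j → P x i * P y j) ∎
  where
  P : ℚ → ℕ → ℚ
  P = pochhammer d

sumℚ-++ : ∀ xs ys → sumℚ (xs ++ ys) ≡ sumℚ xs + sumℚ ys
sumℚ-++ []       ys = sym (ℚ.+-identityˡ (sumℚ ys))
sumℚ-++ (x ∷ xs) ys = trans (cong (x +_) (sumℚ-++ xs ys)) (sym (ℚ.+-assoc x (sumℚ xs) (sumℚ ys)))

sumℚ-concatMap : ∀ {A B : Set} (h : B → ℚ) (f : A → List B) xs →
                 sumℚ (map h (concatMap f xs)) ≡ sumℚ (map (λ x → sumℚ (map h (f x))) xs)
sumℚ-concatMap h f []       = refl
sumℚ-concatMap h f (x ∷ xs) = begin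
  sumℚ (map h (f x ++ concatMap f xs))               ≡⟨ cong sumℚ (List.map-++ h (f x) (concatMap f xs)) ⟩
  sumℚ (map h (f x) ++ map h (concatMap f xs))       ≡⟨ sumℚ-++ (map h (f x)) (map h (concatMap f xs)) ⟩
  sumℚ (map h (f x)) + sumℚ (map h (concatMap f xs)) ≡⟨ cong (sumℚ (map h (f x)) +_) (sumℚ-concatMap h f xs) ⟩
  sumℚ (map h (f x)) + sumℚ (map (λ x → sumℚ (map h (f x))) xs) ∎

sumℚ-map-cong : ∀ {A : Set} {f g : A → ℚ} xs → (∀ x → f x ≡ g x) → sumℚ (map f xs) ≡ sumℚ (map g xs)
sumℚ-map-cong xs f≡g = cong sumℚ (List.map-cong f≡g xs)

sumℚ-*ˡ : ∀ {A : Set} c (f : A → ℚ) xs → sumℚ (map (λ x → c * f x) xs) ≡ c * sumℚ (map f xs)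
sumℚ-*ˡ c f []       = sym (ℚ.*-zeroʳ c)
sumℚ-*ˡ c f (x ∷ xs) = trans (cong (c * f x +_) (sumℚ-*ˡ c f xs)) (sym (ℚ.*-distribˡ-+ c (f x) (sumℚ (map f xs))))

sumℚ-Σ₊ : ∀ {A : Set} n (Φ : ℕ → ℕ → A → ℚ) xs →
          sumℚ (map (λ x → Σ₊ n (λ i j → Φ i j x)) xs) ≡ Σ₊ n (λ i j → sumℚ (map (Φ i j) xs))
sumℚ-Σ₊ n Φ []       = sym (Σ₊-zero n (λ _ _ _ → refl))
sumℚ-Σ₊ n Φ (x ∷ xs) = begin
  Σ₊ n (λ i j → Φ i j x) + sumℚ (map (λ x → Σ₊ n (λ i j → Φ i j x)) xs)
    ≡⟨ cong (Σ₊ n (λ i j → Φ i j x) +_) (sumℚ-Σ₊ n Φ xs) ⟩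
  Σ₊ n (λ i j → Φ i j x) + Σ₊ n (λ i j → sumℚ (map (Φ i j) xs))
    ≡⟨ Σ₊-+ n (λ i j → Φ i j x) (λ i j → sumℚ (map (Φ i j) xs)) ⟨
  Σ₊ n (λ i j → sumℚ (map (Φ i j) (x ∷ xs))) ∎

sumℚ-applyUpTo-Σ₊ : ∀ n Φ → sumℚ (applyUpTo (λ i → Φ i (n ∸ i)) (suc n)) ≡ Σ₊ n Φ
sumℚ-applyUpTo-Σ₊ zero    Φ = ℚ.+-identityʳ (Φ 0 0)
sumℚ-applyUpTo-Σ₊ (suc n) Φ = cong (Φ 0 (suc n) +_) (sumℚ-applyUpTo-Σ₊ n (λ i j → Φ (suc i) j))

sumℚ-upTo-Σ₊ : ∀ n Φ → sumℚ (map (λ i → Φ i (n ∸ i)) (upTo (suc n))) ≡ Σ₊ n Φ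
sumℚ-upTo-Σ₊ n Φ = trans (cong sumℚ (List.map-upTo (λ i → Φ i (n ∸ i)) (suc n))) (sumℚ-applyUpTo-Σ₊ n Φ)

sumP-apply : ∀ {k} {A : Set} (f : A → Poly k) xs γ → sumP (map f xs) γ ≡ sumℚ (map (λ x → f x γ) xs)
sumP-apply f []       γ = refl
sumP-apply f (x ∷ xs) γ = cong (f x γ +_) (sumP-apply f xs γ)

*P-[] : ∀ (f g : Poly 0) → (f *P g) [] ≡ f [] * g []
*P-[] f g = ℚ.+-identityʳ (f [] * g [])

*P-∷ : ∀ {k} (f g : Poly (suc k)) c γ →
       (f *P g) (c ∷ γ) ≡ Σ₊ c (λ a b → ((λ α → f (a ∷ α)) *P (λ β → g (b ∷ β))) γ)
*P-∷ f g c γ = begin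
  (f *P g) (c ∷ γ)
    ≡⟨ sumℚ-concatMap _ (λ a → map (λ { (α , β) → (a ∷ α , (c ∸ a) ∷ β) }) (splits γ)) (upTo (suc c)) ⟩
  sumℚ (map (λ a → sumℚ (map (λ p → f (proj₁ p) * g (proj₂ p)) (map (λ { (α , β) → (a ∷ α , (c ∸ a) ∷ β) }) (splits γ)))) (upTo (suc c)))
    ≡⟨ sumℚ-map-cong (upTo (suc c)) (λ a → cong sumℚ (sym (List.map-∘ (splits γ)))) ⟩
  sumℚ (map (λ a → ((λ α → f (a ∷ α)) *P (λ β → g ((c ∸ a) ∷ β))) γ) (upTo (suc c)))
    ≡⟨ sumℚ-upTo-Σ₊ c (λ a b → ((λ α → f (a ∷ α)) *P (λ β → g (b ∷ β))) γ) ⟩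
  Σ₊ c (λ a b → ((λ α → f (a ∷ α)) *P (λ β → g (b ∷ β))) γ) ∎

*P-cong : ∀ {k} {f f′ g g′ : Poly k} γ → (∀ α → f α ≡ f′ α) → (∀ β → g β ≡ g′ β) → (f *P g) γ ≡ (f′ *P g′) γ
*P-cong γ f≡f′ g≡g′ = sumℚ-map-cong (splits γ) (λ p → cong₂ _*_ (f≡f′ (proj₁ p)) (g≡g′ (proj₂ p)))

*P-Σ₊ˡ : ∀ {k} n (Φ : ℕ → ℕ → Poly k) (g : Poly k) γ →
         ((λ α → Σ₊ n (λ i j → Φ i j α)) *P g) γ ≡ Σ₊ n (λ i j → (Φ i j *P g) γ)
*P-Σ₊ˡ n Φ g γ = begin
  sumℚ (map (λ p → Σ₊ n (λ i j → Φ i j (proj₁ p)) * g (proj₂ p)) (splits γ))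
    ≡⟨ sumℚ-map-cong (splits γ) (λ p → sym (Σ₊-*ʳ n (g (proj₂ p)) (λ i j → Φ i j (proj₁ p)))) ⟩
  sumℚ (map (λ p → Σ₊ n (λ i j → Φ i j (proj₁ p) * g (proj₂ p))) (splits γ))
    ≡⟨ sumℚ-Σ₊ n (λ i j p → Φ i j (proj₁ p) * g (proj₂ p)) (splits γ) ⟩
  Σ₊ n (λ i j → (Φ i j *P g) γ) ∎

*P-Σ₊ʳ : ∀ {k} n (f : Poly k) (Φ : ℕ → ℕ → Poly k) γ →
         (f *P (λ β → Σ₊ n (λ i j → Φ i j β))) γ ≡ Σ₊ n (λ i j → (f *P Φ i j) γ)
*P-Σ₊ʳ n f Φ γ = begin
  sumℚ (map (λ p → f (proj₁ p) * Σ₊ n (λ i j → Φ i j (proj₂ p))) (splits γ))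
    ≡⟨ sumℚ-map-cong (splits γ) (λ p → sym (Σ₊-*ˡ n (f (proj₁ p)) (λ i j → Φ i j (proj₂ p)))) ⟩
  sumℚ (map (λ p → Σ₊ n (λ i j → f (proj₁ p) * Φ i j (proj₂ p))) (splits γ))
    ≡⟨ sumℚ-Σ₊ n (λ i j p → f (proj₁ p) * Φ i j (proj₂ p)) (splits γ) ⟩
  Σ₊ n (λ i j → (f *P Φ i j) γ) ∎

*P-scale : ∀ {k} c d (f g : Poly k) γ → ((λ α → c * f α) *P (λ β → d * g β)) γ ≡ (c * d) * (f *P g) γ
*P-scale c d f g γ = begin
  sumℚ (map (λ p → (c * f (proj₁ p)) * (d * g (proj₂ p))) (splits γ))
    ≡⟨ sumℚ-map-cong (splits γ) (λ p → ℚ*.interchange c (f (proj₁ p)) d (g (proj₂ p))) ⟩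
  sumℚ (map (λ p → (c * d) * (f (proj₁ p) * g (proj₂ p))) (splits γ))
    ≡⟨ sumℚ-*ˡ (c * d) (λ p → f (proj₁ p) * g (proj₂ p)) (splits γ) ⟩
  (c * d) * (f *P g) γ ∎

^ℚ-+ : ∀ w a b → w ^ℚ (a ℕ.+ b) ≡ (w ^ℚ a) * (w ^ℚ b)
^ℚ-+ w zero    b = sym (ℚ.*-identityˡ (w ^ℚ b))
^ℚ-+ w (suc a) b = trans (cong (w *_) (^ℚ-+ w a b)) (sym (ℚ.*-assoc w (w ^ℚ a) (w ^ℚ b)))

weight : ℚ → ℕ → ℕ → ℚ
weight w a c = (w ^ℚ a) * (invFact a * invFact c)

weight-* : ∀ w a b a′ b′ → weight w a a′ * weight w b b′ ≡ weight w (a ℕ.+ b) (a′ ℕ.+ b′) * (binomℚ a b * binomℚ a′ b′)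
weight-* w a b a′ b′ = begin
  ((w ^ℚ a) * (invFact a * invFact a′)) * ((w ^ℚ b) * (invFact b * invFact b′))
    ≡⟨ ℚ*.interchange (w ^ℚ a) _ (w ^ℚ b) _ ⟩
  ((w ^ℚ a) * (w ^ℚ b)) * ((invFact a * invFact a′) * (invFact b * invFact b′))
    ≡⟨ cong₂ _*_ (^ℚ-+ w a b) (ℚ*.interchange (invFact a) (invFact b) (invFact a′) (invFact b′)) ⟨
  (w ^ℚ (a ℕ.+ b)) * ((invFact a * invFact b) * (invFact a′ * invFact b′))
    ≡⟨ cong (λ z → (w ^ℚ (a ℕ.+ b)) * z) (cong₂ _*_ (invFact-* a b) (invFact-* a′ b′)) ⟩
  (w ^ℚ (a ℕ.+ b)) * ((invFact (a ℕ.+ b) * binomℚ a b) * (invFact (a′ ℕ.+ b′) * binomℚ a′ b′))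
    ≡⟨ cong ((w ^ℚ (a ℕ.+ b)) *_) (ℚ*.interchange (invFact (a ℕ.+ b)) (binomℚ a b) (invFact (a′ ℕ.+ b′)) (binomℚ a′ b′)) ⟩
  (w ^ℚ (a ℕ.+ b)) * ((invFact (a ℕ.+ b) * invFact (a′ ℕ.+ b′)) * (binomℚ a b * binomℚ a′ b′))
    ≡⟨ ℚ.*-assoc (w ^ℚ (a ℕ.+ b)) _ _ ⟨
  weight w (a ℕ.+ b) (a′ ℕ.+ b′) * (binomℚ a b * binomℚ a′ b′) ∎

shift : (ℕ → ℕ → ℚ) → ℕ → ℕ → ℕ → ℕ → ℚ
shift F a c b m = F (a ℕ.+ b) (c ℕ.+ m)

-- egf ω F γ is the coefficient of t^γ in Σ_{b,m} F b m u^b v^m / (b! m!),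
-- where u = ω₁ t₁ + ⋯ + ω_k t_k and v = t₁ + ⋯ + t_k.
egf : ∀ {k} → Vec ℚ k → (ℕ → ℕ → ℚ) → Poly k
egf []      F []      = F 0 0
egf (w ∷ ω) F (g ∷ γ) = Σ₊ g (λ a c → weight w a c * egf ω (shift F a c) γ)

egf-cong : ∀ {k} (ω : Vec ℚ k) {F G} γ → (∀ b m → F b m ≡ G b m) → egf ω F γ ≡ egf ω G γ
egf-cong []      []      F≡G = F≡G 0 0
egf-cong (w ∷ ω) (g ∷ γ) F≡G = Σ₊-cong g (λ a c → cong (weight w a c *_) (egf-cong ω γ (λ b m → F≡G (a ℕ.+ b) (c ℕ.+ m))))

egf-cong-on : ∀ {k} (ω : Vec ℚ k) {F G} γ → (∀ b m → b ℕ.+ m ≡ size γ → F b m ≡ G b m) → egf ω F γ ≡ egf ω G γ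
egf-cong-on []      []      F≡G = F≡G 0 0 refl
egf-cong-on (w ∷ ω) (g ∷ γ) F≡G = Σ₊-cong-on g (λ a c a+c≡g → cong (weight w a c *_)
  (egf-cong-on ω γ (λ b m b+m≡ → F≡G (a ℕ.+ b) (c ℕ.+ m) (trans (ℕ+.interchange a b c m) (cong₂ ℕ._+_ a+c≡g b+m≡)))))

egf-+ : ∀ {k} (ω : Vec ℚ k) F G γ → egf ω (λ b m → F b m + G b m) γ ≡ egf ω F γ + egf ω G γ
egf-+ []      F G []      = refl
egf-+ (w ∷ ω) F G (g ∷ γ) = begin
  Σ₊ g (λ a c → weight w a c * egf ω (λ b m → shift F a c b m + shift G a c b m) γ)
    ≡⟨ Σ₊-cong g (λ a c → trans (cong (weight w a c *_) (egf-+ ω (shift F a c) (shift G a c) γ))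
                                (ℚ.*-distribˡ-+ (weight w a c) _ _)) ⟩
  Σ₊ g (λ a c → weight w a c * egf ω (shift F a c) γ + weight w a c * egf ω (shift G a c) γ)
    ≡⟨ Σ₊-+ g _ _ ⟩
  egf (w ∷ ω) F (g ∷ γ) + egf (w ∷ ω) G (g ∷ γ) ∎

egf-*ˡ : ∀ {k} (ω : Vec ℚ k) x F γ → egf ω (λ b m → x * F b m) γ ≡ x * egf ω F γ
egf-*ˡ []      x F []      = refl
egf-*ˡ (w ∷ ω) x F (g ∷ γ) = begin
  Σ₊ g (λ a c → weight w a c * egf ω (λ b m → x * shift F a c b m) γ)
    ≡⟨ Σ₊-cong g (λ a c → trans (cong (weight w a c *_) (egf-*ˡ ω x (shift F a c) γ)) (ℚ*.x∙yz≈y∙xz (weight w a c) x _)) ⟩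
  Σ₊ g (λ a c → x * (weight w a c * egf ω (shift F a c) γ))
    ≡⟨ Σ₊-*ˡ g x _ ⟩
  x * egf (w ∷ ω) F (g ∷ γ) ∎

egf-zero : ∀ {k} (ω : Vec ℚ k) F γ → (∀ b m → F b m ≡ 0ℚ) → egf ω F γ ≡ 0ℚ
egf-zero ω F γ F≡0 = begin
  egf ω F γ                        ≡⟨ egf-cong ω γ (λ b m → trans (F≡0 b m) (sym (ℚ.*-zeroˡ 0ℚ))) ⟩
  egf ω (λ _ _ → 0ℚ * 0ℚ) γ        ≡⟨ egf-*ˡ ω 0ℚ (λ _ _ → 0ℚ) γ ⟩
  0ℚ * egf ω (λ _ _ → 0ℚ) γ        ≡⟨ ℚ.*-zeroˡ (egf ω (λ _ _ → 0ℚ) γ) ⟩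
  0ℚ                               ∎

egf-sumℚ : ∀ {k} (ω : Vec ℚ k) {A : Set} (F : A → ℕ → ℕ → ℚ) xs γ →
           egf ω (λ b m → sumℚ (map (λ x → F x b m) xs)) γ ≡ sumℚ (map (λ x → egf ω (F x) γ) xs)
egf-sumℚ ω F []       γ = egf-zero ω _ γ (λ _ _ → refl)
egf-sumℚ ω F (x ∷ xs) γ = trans (egf-+ ω (F x) _ γ) (cong (egf ω (F x) γ +_) (egf-sumℚ ω F xs γ))

egf-Σ₊ : ∀ {k} (ω : Vec ℚ k) n (Φ : ℕ → ℕ → ℕ → ℕ → ℚ) γ →
         egf ω (λ b m → Σ₊ n (λ i j → Φ i j b m)) γ ≡ Σ₊ n (λ i j → egf ω (Φ i j) γ)
egf-Σ₊ ω zero    Φ γ = refl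
egf-Σ₊ ω (suc n) Φ γ = trans (egf-+ ω (Φ 0 (suc n)) _ γ) (cong (egf ω (Φ 0 (suc n)) γ +_) (egf-Σ₊ ω n (λ i j → Φ (suc i) j) γ))

egf-Σbin : ∀ {k} (ω : Vec ℚ k) n (Φ : ℕ → ℕ → ℕ → ℕ → ℚ) γ →
           egf ω (λ b m → Σbin n (λ i j → Φ i j b m)) γ ≡ Σbin n (λ i j → egf ω (Φ i j) γ)
egf-Σbin ω n Φ γ = trans (egf-Σ₊ ω n (λ i j b m → binomℚ i j * Φ i j b m) γ)
                         (Σ₊-cong n (λ i j → egf-*ˡ ω (binomℚ i j) (Φ i j) γ))

egf-isZero : ∀ {k} (ω : Vec ℚ k) F γ → isZero γ ≡ true → egf ω F γ ≡ F 0 0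
egf-isZero []      F []          _       = refl
egf-isZero (w ∷ ω) F (zero ∷ γ)  γ≡0 = trans (ℚ.*-identityˡ (egf ω F γ)) (egf-isZero ω F γ γ≡0)
egf-isZero (w ∷ ω) F (suc _ ∷ γ) ()

δ : ℕ → ℕ → ℚ
δ zero    zero    = 1ℚ
δ zero    (suc m) = 0ℚ
δ (suc b) m       = 0ℚ

egf-δ : ∀ {k} (ω : Vec ℚ k) γ → egf ω δ γ ≡ oneP γ
egf-δ []      []          = refl
egf-δ (w ∷ ω) (zero ∷ γ)  = trans (ℚ.*-identityˡ (egf ω δ γ)) (egf-δ ω γ)
egf-δ (w ∷ ω) (suc g ∷ γ) =
  Σ₊-zero (suc g) (λ a c a+c≡ → trans (cong (weight w a c *_) (shifted-δ≡0 a c a+c≡)) (ℚ.*-zeroʳ (weight w a c)))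
  where
  shifted-δ≡0 : ∀ a c → a ℕ.+ c ≡ suc g → egf ω (shift δ a c) γ ≡ 0ℚ
  shifted-δ≡0 (suc a) c       _ = egf-zero ω _ γ (λ _ _ → refl)
  shifted-δ≡0 zero    (suc c) _ = egf-zero ω _ γ (λ { zero _ → refl ; (suc _) _ → refl })
  shifted-δ≡0 zero    zero    ()

_⊛_ : (ℕ → ℕ → ℚ) → (ℕ → ℕ → ℚ) → ℕ → ℕ → ℚ
(F ⊛ G) b m = Σbin b (λ b₁ b₂ → Σbin m (λ m₁ m₂ → F b₁ m₁ * G b₂ m₂))

⊛-shift : ∀ F G A M x y →
          Σbin A (λ a b → Σbin M (λ a′ b′ → (shift F a a′ ⊛ shift G b b′) x y)) ≡ (F ⊛ G) (A ℕ.+ x) (M ℕ.+ y)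
⊛-shift F G A M x y = sym (begin
  Σbin (A ℕ.+ x) (λ x₁ x₂ → Σbin (M ℕ.+ y) (λ y₁ y₂ → F x₁ y₁ * G x₂ y₂))
    ≡⟨ Σbin-split A x _ ⟩
  Σbin A (λ a b → Σbin x (λ x₁ x₂ → Σbin (M ℕ.+ y) (λ y₁ y₂ → F (a ℕ.+ x₁) y₁ * G (b ℕ.+ x₂) y₂)))
    ≡⟨ Σbin-cong A (λ a b → Σbin-cong x (λ x₁ x₂ → Σbin-split M y _)) ⟩
  Σbin A (λ a b → Σbin x (λ x₁ x₂ → Σbin M (λ a′ b′ → Σbin y (λ y₁ y₂ → F (a ℕ.+ x₁) (a′ ℕ.+ y₁) * G (b ℕ.+ x₂) (b′ ℕ.+ y₂)))))
    ≡⟨ Σbin-cong A (λ a b → Σbin-comm x M _) ⟩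
  Σbin A (λ a b → Σbin M (λ a′ b′ → Σbin x (λ x₁ x₂ → Σbin y (λ y₁ y₂ → F (a ℕ.+ x₁) (a′ ℕ.+ y₁) * G (b ℕ.+ x₂) (b′ ℕ.+ y₂))))) ∎)

Σ₊-Σ₊-Σ₊-regroup : ∀ g (Φ : ℕ → ℕ → ℕ → ℕ → ℚ) →
                   Σ₊ g (λ c c′ → Σ₊ c (λ a a′ → Σ₊ c′ (λ b b′ → Φ a a′ b b′))) ≡
                   Σ₊ g (λ A M → Σ₊ A (λ a b → Σ₊ M (λ a′ b′ → Φ a a′ b b′)))
Σ₊-Σ₊-Σ₊-regroup g Φ = begin
  Σ₊ g (λ c c′ → Σ₊ c (λ a a′ → Σ₊ c′ (λ b b′ → Φ a a′ b b′)))
    ≡⟨ Σ₊-assoc g (λ a a′ c′ → Σ₊ c′ (λ b b′ → Φ a a′ b b′)) ⟨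
  Σ₊ g (λ a j → Σ₊ j (λ a′ c′ → Σ₊ c′ (λ b b′ → Φ a a′ b b′)))
    ≡⟨ Σ₊-cong g (λ a j → inner a j) ⟩
  Σ₊ g (λ a j → Σ₊ j (λ b r → Σ₊ r (λ a′ b′ → Φ a a′ b b′)))
    ≡⟨ Σ₊-assoc g (λ a b r → Σ₊ r (λ a′ b′ → Φ a a′ b b′)) ⟩
  Σ₊ g (λ A M → Σ₊ A (λ a b → Σ₊ M (λ a′ b′ → Φ a a′ b b′))) ∎
  where
  inner : ∀ a j → Σ₊ j (λ a′ c′ → Σ₊ c′ (λ b b′ → Φ a a′ b b′)) ≡ Σ₊ j (λ b r → Σ₊ r (λ a′ b′ → Φ a a′ b b′))
  inner a j = begin
    Σ₊ j (λ a′ c′ → Σ₊ c′ (λ b b′ → Φ a a′ b b′))   ≡⟨ Σ₊-assoc j (λ a′ b b′ → Φ a a′ b b′) ⟩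
    Σ₊ j (λ m b′ → Σ₊ m (λ a′ b → Φ a a′ b b′))     ≡⟨ Σ₊-cong j (λ m b′ → Σ₊-comm m (λ a′ b → Φ a a′ b b′)) ⟩
    Σ₊ j (λ m b′ → Σ₊ m (λ b a′ → Φ a a′ b b′))     ≡⟨ Σ₊-assoc j (λ b a′ b′ → Φ a a′ b b′) ⟨
    Σ₊ j (λ b r → Σ₊ r (λ a′ b′ → Φ a a′ b b′))     ∎

-- weight-* turns a product of two weights into one weight times binomial coefficients,
-- which is why products of egf's are egf's of binomial convolutions.
egf-shift-⊛ : ∀ {k} (ω : Vec ℚ k) F G γ w A M →
              Σ₊ A (λ a b → Σ₊ M (λ a′ b′ → (weight w a a′ * weight w b b′) * egf ω (shift F a a′ ⊛ shift G b b′) γ)) ≡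
              weight w A M * egf ω (shift (F ⊛ G) A M) γ
egf-shift-⊛ ω F G γ w A M = begin
  Σ₊ A (λ a b → Σ₊ M (λ a′ b′ → (weight w a a′ * weight w b b′) * Z a a′ b b′))
    ≡⟨ Σ₊-cong-on A (λ a b a+b≡A → Σ₊-cong-on M (λ a′ b′ a′+b′≡M → factor a b a′ b′ a+b≡A a′+b′≡M)) ⟩
  Σ₊ A (λ a b → Σ₊ M (λ a′ b′ → weight w A M * (binomℚ a b * (binomℚ a′ b′ * Z a a′ b b′))))
    ≡⟨ Σ₊-cong A (λ a b → trans (Σ₊-*ˡ M (weight w A M) _) (cong (weight w A M *_) (Σ₊-*ˡ M (binomℚ a b) _))) ⟩
  Σ₊ A (λ a b → weight w A M * (binomℚ a b * Σbin M (λ a′ b′ → Z a a′ b b′)))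
    ≡⟨ Σ₊-*ˡ A (weight w A M) _ ⟩
  weight w A M * Σbin A (λ a b → Σbin M (λ a′ b′ → Z a a′ b b′))
    ≡⟨ cong (weight w A M *_) (trans (egf-Σbin ω A _ γ) (Σbin-cong A (λ a b → egf-Σbin ω M _ γ))) ⟨
  weight w A M * egf ω (λ x y → Σbin A (λ a b → Σbin M (λ a′ b′ → (shift F a a′ ⊛ shift G b b′) x y))) γ
    ≡⟨ cong (weight w A M *_) (egf-cong ω γ (⊛-shift F G A M)) ⟩
  weight w A M * egf ω (shift (F ⊛ G) A M) γ ∎
  where
  Z : ℕ → ℕ → ℕ → ℕ → ℚ
  Z a a′ b b′ = egf ω (shift F a a′ ⊛ shift G b b′) γ
  factor : ∀ a b a′ b′ → a ℕ.+ b ≡ A → a′ ℕ.+ b′ ≡ M →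
           (weight w a a′ * weight w b b′) * Z a a′ b b′ ≡ weight w A M * (binomℚ a b * (binomℚ a′ b′ * Z a a′ b b′))
  factor a b a′ b′ refl refl = trans (cong (_* Z a a′ b b′) (weight-* w a b a′ b′))
                                     (trans (ℚ.*-assoc (weight w (a ℕ.+ b) (a′ ℕ.+ b′)) (binomℚ a b * binomℚ a′ b′) (Z a a′ b b′))
                                            (cong (weight w (a ℕ.+ b) (a′ ℕ.+ b′) *_) (ℚ.*-assoc (binomℚ a b) (binomℚ a′ b′) (Z a a′ b b′))))

egf-*P : ∀ {k} (ω : Vec ℚ k) F G γ → (egf ω F *P egf ω G) γ ≡ egf ω (F ⊛ G) γ
egf-*P []      F G []      = trans (*P-[] (egf [] F) (egf [] G))
  (sym (trans (ℚ.*-identityˡ (1ℚ * (F 0 0 * G 0 0))) (ℚ.*-identityˡ (F 0 0 * G 0 0))))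
egf-*P (w ∷ ω) F G (g ∷ γ) = begin
  (egf (w ∷ ω) F *P egf (w ∷ ω) G) (g ∷ γ)
    ≡⟨ *P-∷ (egf (w ∷ ω) F) (egf (w ∷ ω) G) g γ ⟩
  Σ₊ g (λ c c′ → ((λ α → egf (w ∷ ω) F (c ∷ α)) *P (λ β → egf (w ∷ ω) G (c′ ∷ β))) γ)
    ≡⟨ Σ₊-cong g expand ⟩
  Σ₊ g (λ c c′ → Σ₊ c (λ a a′ → Σ₊ c′ (λ b b′ → Φ a a′ b b′)))
    ≡⟨ Σ₊-Σ₊-Σ₊-regroup g Φ ⟩
  Σ₊ g (λ A M → Σ₊ A (λ a b → Σ₊ M (λ a′ b′ → Φ a a′ b b′)))
    ≡⟨ Σ₊-cong g (egf-shift-⊛ ω F G γ w) ⟩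
  egf (w ∷ ω) (F ⊛ G) (g ∷ γ) ∎
  where
  Φ : ℕ → ℕ → ℕ → ℕ → ℚ
  Φ a a′ b b′ = (weight w a a′ * weight w b b′) * egf ω (shift F a a′ ⊛ shift G b b′) γ

  expand : ∀ c c′ → ((λ α → egf (w ∷ ω) F (c ∷ α)) *P (λ β → egf (w ∷ ω) G (c′ ∷ β))) γ ≡
                    Σ₊ c (λ a a′ → Σ₊ c′ (λ b b′ → Φ a a′ b b′))
  expand c c′ = begin
    ((λ α → Σ₊ c (λ a a′ → f a a′ α)) *P (λ β → Σ₊ c′ (λ b b′ → h b b′ β))) γ
      ≡⟨ *P-Σ₊ˡ c f _ γ ⟩
    Σ₊ c (λ a a′ → (f a a′ *P (λ β → Σ₊ c′ (λ b b′ → h b b′ β))) γ)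
      ≡⟨ Σ₊-cong c (λ a a′ → *P-Σ₊ʳ c′ (f a a′) h γ) ⟩
    Σ₊ c (λ a a′ → Σ₊ c′ (λ b b′ → (f a a′ *P h b b′) γ))
      ≡⟨ Σ₊-cong c (λ a a′ → Σ₊-cong c′ (λ b b′ →
           trans (*P-scale (weight w a a′) (weight w b b′) (egf ω (shift F a a′)) (egf ω (shift G b b′)) γ)
                 (cong ((weight w a a′ * weight w b b′) *_) (egf-*P ω (shift F a a′) (shift G b b′) γ)))) ⟩
    Σ₊ c (λ a a′ → Σ₊ c′ (λ b b′ → Φ a a′ b b′)) ∎
    where
    f h : ℕ → ℕ → Poly _
    f a a′ α = weight w a a′ * egf ω (shift F a a′) α
    h b b′ β = weight w b b′ * egf ω (shift G b b′) β

D-D₁ : ∀ {k} j (p : WPoly k) → D j (D₁ p) ≡ D₁ (D j p)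
D-D₁ zero    p = refl
D-D₁ (suc j) p = cong D₁ (D-D₁ j p)

D-++ : ∀ {k} j (p q : WPoly k) → D j (p ++ q) ≡ D j p ++ D j q
D-++ zero    p q = refl
D-++ (suc j) p q = trans (cong D₁ (D-++ j p q)) (List.concatMap-++ _ (D j p) (D j q))

D-[] : ∀ {k} j → D {k} j [] ≡ []
D-[] zero    = refl
D-[] (suc j) = cong D₁ (D-[] j)

scale : ∀ {k} → ℚ → WPoly k → WPoly k
scale c = map (λ t → (c * proj₁ t , proj₂ t))

D₁-scale : ∀ {k} c (p : WPoly k) → D₁ (scale c p) ≡ scale c (D₁ p)
D₁-scale c []      = refl
D₁-scale c (t ∷ p) = begin
  map (λ u → ((c * proj₁ t) * ℕ→ℚ (proj₁ u) , proj₂ u)) (partials (proj₂ t)) ++ D₁ (scale c p)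
    ≡⟨ cong₂ _++_ (trans (List.map-cong (λ u → cong (_, proj₂ u) (ℚ.*-assoc c (proj₁ t) (ℕ→ℚ (proj₁ u)))) (partials (proj₂ t)))
                         (List.map-∘ (partials (proj₂ t))))
                  (D₁-scale c p) ⟩
  scale c (map (λ u → (proj₁ t * ℕ→ℚ (proj₁ u) , proj₂ u)) (partials (proj₂ t))) ++ scale c (D₁ p)
    ≡⟨ List.map-++ _ (map (λ u → (proj₁ t * ℕ→ℚ (proj₁ u) , proj₂ u)) (partials (proj₂ t))) (D₁ p) ⟨
  scale c (D₁ (t ∷ p)) ∎

D-scale : ∀ {k} j c (p : WPoly k) → D j (scale c p) ≡ scale c (D j p)
D-scale zero    c p = refl
D-scale (suc j) c p = trans (cong D₁ (D-scale j c p)) (D₁-scale c (D j p))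

evalW-++ : ∀ {k} (ω : Vec ℚ k) p q → evalW ω (p ++ q) ≡ evalW ω p + evalW ω q
evalW-++ ω p q = trans (cong sumℚ (List.map-++ term p q)) (sumℚ-++ (map term p) (map term q))
  where
  term : ℚ × Vec ℕ _ → ℚ
  term t = proj₁ t * evalMono ω (proj₂ t)

evalW-scale : ∀ {k} (ω : Vec ℚ k) c p → evalW ω (scale c p) ≡ c * evalW ω p
evalW-scale ω c []      = sym (ℚ.*-zeroʳ c)
evalW-scale ω c (t ∷ p) = begin
  (c * proj₁ t) * evalMono ω (proj₂ t) + evalW ω (scale c p)
    ≡⟨ cong₂ _+_ (ℚ.*-assoc c (proj₁ t) _) (evalW-scale ω c p) ⟩
  c * (proj₁ t * evalMono ω (proj₂ t)) + c * evalW ω p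
    ≡⟨ ℚ.*-distribˡ-+ c _ _ ⟨
  c * evalW ω (t ∷ p) ∎

evalD : ∀ {k} → Vec ℚ k → ℕ → Vec ℕ k → ℚ
evalD ω j α = evalW ω (D j (monomial α))

evalW-D : ∀ {k} (ω : Vec ℚ k) j p → evalW ω (D j p) ≡ sumℚ (map (λ t → proj₁ t * evalD ω j (proj₂ t)) p)
evalW-D ω j []      = cong (evalW ω) (D-[] j)
evalW-D ω j (t ∷ p) = begin
  evalW ω (D j ((t ∷ []) ++ p))
    ≡⟨ trans (cong (evalW ω) (D-++ j (t ∷ []) p)) (evalW-++ ω (D j (t ∷ [])) (D j p)) ⟩
  evalW ω (D j (t ∷ [])) + evalW ω (D j p)
    ≡⟨ cong₂ _+_ monomial-term (evalW-D ω j p) ⟩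
  proj₁ t * evalD ω j (proj₂ t) + sumℚ (map (λ t → proj₁ t * evalD ω j (proj₂ t)) p) ∎
  where
  monomial-term : evalW ω (D j (t ∷ [])) ≡ proj₁ t * evalD ω j (proj₂ t)
  monomial-term = begin
    evalW ω (D j (t ∷ []))
      ≡⟨ cong (λ c → evalW ω (D j ((c , proj₂ t) ∷ []))) (ℚ.*-identityʳ (proj₁ t)) ⟨
    evalW ω (D j (scale (proj₁ t) (monomial (proj₂ t))))
      ≡⟨ cong (evalW ω) (D-scale j (proj₁ t) (monomial (proj₂ t))) ⟩
    evalW ω (scale (proj₁ t) (D j (monomial (proj₂ t))))
      ≡⟨ evalW-scale ω (proj₁ t) (D j (monomial (proj₂ t))) ⟩
    proj₁ t * evalD ω j (proj₂ t) ∎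

evalD-suc : ∀ {k} (ω : Vec ℚ k) j α →
            evalD ω (suc j) α ≡ sumℚ (map (λ t → ℕ→ℚ (proj₁ t) * evalD ω j (proj₂ t)) (partials α))
evalD-suc ω j α = begin
  evalW ω (D₁ (D j (monomial α)))
    ≡⟨ cong (evalW ω) (D-D₁ j (monomial α)) ⟨
  evalW ω (D j (D₁ (monomial α)))
    ≡⟨ cong (λ p → evalW ω (D j p)) (List.++-identityʳ (map ∂ (partials α))) ⟩
  evalW ω (D j (map ∂ (partials α)))
    ≡⟨ evalW-D ω j (map ∂ (partials α)) ⟩
  sumℚ (map (λ t → proj₁ t * evalD ω j (proj₂ t)) (map ∂ (partials α)))
    ≡⟨ cong sumℚ (List.map-∘ (partials α)) ⟨
  sumℚ (map (λ t → (1ℚ * ℕ→ℚ (proj₁ t)) * evalD ω j (proj₂ t)) (partials α))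
    ≡⟨ sumℚ-map-cong (partials α) (λ t → cong (_* evalD ω j (proj₂ t)) (ℚ.*-identityˡ (ℕ→ℚ (proj₁ t)))) ⟩
  sumℚ (map (λ t → ℕ→ℚ (proj₁ t) * evalD ω j (proj₂ t)) (partials α)) ∎
  where
  ∂ : ℕ × Vec ℕ _ → ℚ × Vec ℕ _
  ∂ u = (1ℚ * ℕ→ℚ (proj₁ u) , proj₂ u)

sgn : ℕ → ℚ
sgn zero    = 0ℚ
sgn (suc _) = 1ℚ

-- timesV X α is the coefficient of t^α in (t₁ + ⋯ + t_k) X; sgn discards the entries of partials α
-- with α_i = 0, whose exponent α_i ∸ 1 is junk.
timesV : ∀ {k} → Poly k → Poly k
timesV X α = sumℚ (map (λ t → sgn (proj₁ t) * X (proj₂ t)) (partials α))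

invFact-*-ℕ→ℚ : ∀ a → invFact a * ℕ→ℚ a ≡ sgn a * invFact (a ∸ 1)
invFact-*-ℕ→ℚ zero    = trans (ℚ.*-zeroʳ (invFact 0)) (sym (ℚ.*-zeroˡ (invFact 0)))
invFact-*-ℕ→ℚ (suc a) = trans (invFact-suc a) (sym (ℚ.*-identityˡ (invFact a)))

invFactProd-*-partials : ∀ {k} (α : Vec ℕ k) (X : Vec ℕ k → ℚ) →
                         invFactProd α * sumℚ (map (λ t → ℕ→ℚ (proj₁ t) * X (proj₂ t)) (partials α)) ≡
                         timesV (λ β → invFactProd β * X β) α
invFactProd-*-partials []      X = ℚ.*-zeroʳ (invFactProd [])
invFactProd-*-partials (a ∷ α) X = begin
  invFactProd (a ∷ α) * (ℕ→ℚ a * X ((a ∸ 1) ∷ α) + sumℚ (map (λ t → ℕ→ℚ (proj₁ t) * X (proj₂ t)) (map cons (partials α))))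
    ≡⟨ cong₂ (λ u v → u * (ℕ→ℚ a * X ((a ∸ 1) ∷ α) + sumℚ v)) (invFactProd-∷ a α) (sym (List.map-∘ (partials α))) ⟩
  (invFact a * invFactProd α) * (ℕ→ℚ a * X ((a ∸ 1) ∷ α) + Σ′)
    ≡⟨ expand (invFact a) (invFactProd α) (ℕ→ℚ a) (X ((a ∸ 1) ∷ α)) Σ′ ⟩
  (invFact a * ℕ→ℚ a) * (invFactProd α * X ((a ∸ 1) ∷ α)) + invFact a * (invFactProd α * Σ′)
    ≡⟨ cong₂ (λ u v → u * (invFactProd α * X ((a ∸ 1) ∷ α)) + invFact a * v)
             (invFact-*-ℕ→ℚ a) (invFactProd-*-partials α (λ β → X (a ∷ β))) ⟩
  (sgn a * invFact (a ∸ 1)) * (invFactProd α * X ((a ∸ 1) ∷ α)) + invFact a * timesV (λ β → invFactProd β * X (a ∷ β)) α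
    ≡⟨ cong₂ _+_ lowered unchanged ⟩
  sgn a * (invFactProd ((a ∸ 1) ∷ α) * X ((a ∸ 1) ∷ α)) +
    sumℚ (map (λ t → sgn (proj₁ t) * (invFactProd (proj₂ t) * X (proj₂ t))) (map cons (partials α))) ∎
  where
  cons : ℕ × Vec ℕ _ → ℕ × Vec ℕ _
  cons t = (proj₁ t , a ∷ proj₂ t)
  Σ′ : ℚ
  Σ′ = sumℚ (map (λ t → ℕ→ℚ (proj₁ t) * X (a ∷ proj₂ t)) (partials α))
  expand : ∀ i f n x s → (i * f) * (n * x + s) ≡ (i * n) * (f * x) + i * (f * s)
  expand = solve-∀ ℚ-ring
  lowered : (sgn a * invFact (a ∸ 1)) * (invFactProd α * X ((a ∸ 1) ∷ α)) ≡ sgn a * (invFactProd ((a ∸ 1) ∷ α) * X ((a ∸ 1) ∷ α))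
  lowered = trans (ℚ.*-assoc (sgn a) _ _) (cong (sgn a *_) (trans (sym (ℚ.*-assoc (invFact (a ∸ 1)) _ _))
                                                                  (cong (_* X ((a ∸ 1) ∷ α)) (sym (invFactProd-∷ (a ∸ 1) α)))))
  unchanged : invFact a * timesV (λ β → invFactProd β * X (a ∷ β)) α ≡
              sumℚ (map (λ t → sgn (proj₁ t) * (invFactProd (proj₂ t) * X (proj₂ t))) (map cons (partials α)))
  unchanged = begin
    invFact a * timesV (λ β → invFactProd β * X (a ∷ β)) α
      ≡⟨ sumℚ-*ˡ (invFact a) _ (partials α) ⟨
    sumℚ (map (λ t → invFact a * (sgn (proj₁ t) * (invFactProd (proj₂ t) * X (a ∷ proj₂ t)))) (partials α))
      ≡⟨ sumℚ-map-cong (partials α) (λ t → trans (ℚ*.x∙yz≈y∙xz (invFact a) (sgn (proj₁ t)) _)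
           (cong (sgn (proj₁ t) *_) (trans (sym (ℚ.*-assoc (invFact a) _ _))
                                           (cong (_* X (a ∷ proj₂ t)) (sym (invFactProd-∷ a (proj₂ t))))))) ⟩
    sumℚ (map (λ t → sgn (proj₁ t) * (invFactProd (a ∷ proj₂ t) * X (a ∷ proj₂ t))) (partials α))
      ≡⟨ cong sumℚ (List.map-∘ (partials α)) ⟩
    sumℚ (map (λ t → sgn (proj₁ t) * (invFactProd (proj₂ t) * X (proj₂ t))) (map cons (partials α))) ∎

timesV-Σ₊ : ∀ {k} g (c : ℕ → ℕ → ℚ) (X : ℕ → ℕ → Poly k) γ →
            timesV (λ β → Σ₊ g (λ a b → c a b * X a b β)) γ ≡ Σ₊ g (λ a b → c a b * timesV (X a b) γ)
timesV-Σ₊ g c X γ = begin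
  sumℚ (map (λ t → sgn (proj₁ t) * Σ₊ g (λ a b → c a b * X a b (proj₂ t))) (partials γ))
    ≡⟨ sumℚ-map-cong (partials γ) (λ t → trans (sym (Σ₊-*ˡ g (sgn (proj₁ t)) _))
                                              (Σ₊-cong g (λ a b → ℚ*.x∙yz≈y∙xz (sgn (proj₁ t)) (c a b) _))) ⟩
  sumℚ (map (λ t → Σ₊ g (λ a b → c a b * (sgn (proj₁ t) * X a b (proj₂ t)))) (partials γ))
    ≡⟨ sumℚ-Σ₊ g (λ a b t → c a b * (sgn (proj₁ t) * X a b (proj₂ t))) (partials γ) ⟩
  Σ₊ g (λ a b → sumℚ (map (λ t → c a b * (sgn (proj₁ t) * X a b (proj₂ t))) (partials γ)))
    ≡⟨ Σ₊-cong g (λ a b → sumℚ-*ˡ (c a b) _ (partials γ)) ⟩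
  Σ₊ g (λ a b → c a b * timesV (X a b) γ) ∎

timesVᵉ : (ℕ → ℕ → ℚ) → ℕ → ℕ → ℚ
timesVᵉ F b c = ℕ→ℚ c * F b (c ∸ 1)

timesVᵉ-shift : ∀ F a c b m → shift (timesVᵉ F) a c b m ≡ timesVᵉ (shift F a c) b m + ℕ→ℚ c * shift F a (c ∸ 1) b m
timesVᵉ-shift F a zero    b m = sym (trans (cong (timesVᵉ (shift F a 0) b m +_) (ℚ.*-zeroˡ (F (a ℕ.+ b) m)))
                                             (ℚ.+-identityʳ (timesVᵉ (shift F a 0) b m)))
timesVᵉ-shift F a (suc c) b zero = begin
  ℕ→ℚ (suc (c ℕ.+ 0)) * F (a ℕ.+ b) (c ℕ.+ 0)
    ≡⟨ cong (λ z → ℕ→ℚ (suc z) * F (a ℕ.+ b) (c ℕ.+ 0)) (ℕ.+-identityʳ c) ⟩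
  ℕ→ℚ (suc c) * F (a ℕ.+ b) (c ℕ.+ 0)
    ≡⟨ ℚ.+-identityˡ _ ⟨
  0ℚ + ℕ→ℚ (suc c) * F (a ℕ.+ b) (c ℕ.+ 0)
    ≡⟨ cong (_+ ℕ→ℚ (suc c) * F (a ℕ.+ b) (c ℕ.+ 0)) (ℚ.*-zeroˡ (F (a ℕ.+ b) (suc c ℕ.+ 0))) ⟨
  0ℚ * F (a ℕ.+ b) (suc c ℕ.+ 0) + ℕ→ℚ (suc c) * F (a ℕ.+ b) (c ℕ.+ 0) ∎
timesVᵉ-shift F a (suc c) b (suc m) = begin
  ℕ→ℚ (suc c ℕ.+ suc m) * F (a ℕ.+ b) (c ℕ.+ suc m)
    ≡⟨ cong (_* F (a ℕ.+ b) (c ℕ.+ suc m)) (trans (ℕ→ℚ-+ (suc c) (suc m)) (ℚ.+-comm (ℕ→ℚ (suc c)) (ℕ→ℚ (suc m)))) ⟩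
  (ℕ→ℚ (suc m) + ℕ→ℚ (suc c)) * F (a ℕ.+ b) (c ℕ.+ suc m)
    ≡⟨ ℚ.*-distribʳ-+ (F (a ℕ.+ b) (c ℕ.+ suc m)) (ℕ→ℚ (suc m)) (ℕ→ℚ (suc c)) ⟩
  ℕ→ℚ (suc m) * F (a ℕ.+ b) (c ℕ.+ suc m) + ℕ→ℚ (suc c) * F (a ℕ.+ b) (c ℕ.+ suc m)
    ≡⟨ cong (λ z → ℕ→ℚ (suc m) * F (a ℕ.+ b) z + ℕ→ℚ (suc c) * F (a ℕ.+ b) (c ℕ.+ suc m)) (ℕ.+-suc c m) ⟩
  ℕ→ℚ (suc m) * F (a ℕ.+ b) (suc c ℕ.+ m) + ℕ→ℚ (suc c) * F (a ℕ.+ b) (c ℕ.+ suc m) ∎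

weight-suc : ∀ w a c → weight w a (suc c) * ℕ→ℚ (suc c) ≡ weight w a c
weight-suc w a c = begin
  ((w ^ℚ a) * (invFact a * invFact (suc c))) * ℕ→ℚ (suc c)
    ≡⟨ trans (ℚ.*-assoc (w ^ℚ a) _ _) (cong ((w ^ℚ a) *_) (ℚ.*-assoc (invFact a) _ _)) ⟩
  (w ^ℚ a) * (invFact a * (invFact (suc c) * ℕ→ℚ (suc c)))
    ≡⟨ cong (λ z → (w ^ℚ a) * (invFact a * z)) (invFact-suc c) ⟩
  weight w a c ∎

Σ₊-weight-lower : ∀ w g (H : ℕ → ℕ → ℚ) →
                  Σ₊ g (λ a c → weight w a c * (ℕ→ℚ c * H a (c ∸ 1))) ≡ sgn g * Σ₊ (g ∸ 1) (λ a c → weight w a c * H a c)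
Σ₊-weight-lower w zero    H = trans (trans (cong (weight w 0 0 *_) (ℚ.*-zeroˡ (H 0 0))) (ℚ.*-zeroʳ (weight w 0 0)))
                                    (sym (ℚ.*-zeroˡ (weight w 0 0 * H 0 0)))
Σ₊-weight-lower w (suc g) H = begin
  Σ₊ (suc g) (λ a c → weight w a c * (ℕ→ℚ c * H a (c ∸ 1)))
    ≡⟨ Σ₊-sucʳ g (λ a c → weight w a c * (ℕ→ℚ c * H a (c ∸ 1))) ⟩
  Σ₊ g (λ a c → weight w a (suc c) * (ℕ→ℚ (suc c) * H a c)) + weight w (suc g) 0 * (0ℚ * H (suc g) 0)
    ≡⟨ cong₂ _+_ (Σ₊-cong g (λ a c → trans (sym (ℚ.*-assoc (weight w a (suc c)) _ _)) (cong (_* H a c) (weight-suc w a c))))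
                 (trans (cong (weight w (suc g) 0 *_) (ℚ.*-zeroˡ (H (suc g) 0))) (ℚ.*-zeroʳ (weight w (suc g) 0))) ⟩
  Σ₊ g (λ a c → weight w a c * H a c) + 0ℚ
    ≡⟨ ℚ.+-identityʳ _ ⟩
  Σ₊ g (λ a c → weight w a c * H a c)
    ≡⟨ ℚ.*-identityˡ _ ⟨
  1ℚ * Σ₊ g (λ a c → weight w a c * H a c) ∎

egf-shift-timesVᵉ : ∀ {k} (ω : Vec ℚ k) F a c γ →
                    egf ω (shift (timesVᵉ F) a c) γ ≡ egf ω (timesVᵉ (shift F a c)) γ + ℕ→ℚ c * egf ω (shift F a (c ∸ 1)) γ
egf-shift-timesVᵉ ω F a c γ = begin
  egf ω (shift (timesVᵉ F) a c) γ
    ≡⟨ egf-cong ω γ (timesVᵉ-shift F a c) ⟩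
  egf ω (λ b m → timesVᵉ (shift F a c) b m + ℕ→ℚ c * shift F a (c ∸ 1) b m) γ
    ≡⟨ egf-+ ω (timesVᵉ (shift F a c)) _ γ ⟩
  egf ω (timesVᵉ (shift F a c)) γ + egf ω (λ b m → ℕ→ℚ c * shift F a (c ∸ 1) b m) γ
    ≡⟨ cong (egf ω (timesVᵉ (shift F a c)) γ +_) (egf-*ˡ ω (ℕ→ℚ c) (shift F a (c ∸ 1)) γ) ⟩
  egf ω (timesVᵉ (shift F a c)) γ + ℕ→ℚ c * egf ω (shift F a (c ∸ 1)) γ ∎

egf-timesV : ∀ {k} (ω : Vec ℚ k) F α → timesV (egf ω F) α ≡ egf ω (timesVᵉ F) α
egf-timesV []      F []      = sym (ℚ.*-zeroˡ (F 0 0))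
egf-timesV (w ∷ ω) F (g ∷ γ) = begin
  sgn g * egf (w ∷ ω) F ((g ∸ 1) ∷ γ) + sumℚ (map (λ t → sgn (proj₁ t) * egf (w ∷ ω) F (proj₂ t)) (map cons (partials γ)))
    ≡⟨ cong (λ z → sgn g * egf (w ∷ ω) F ((g ∸ 1) ∷ γ) + sumℚ z) (List.map-∘ (partials γ)) ⟨
  sgn g * egf (w ∷ ω) F ((g ∸ 1) ∷ γ) + timesV (λ β → egf (w ∷ ω) F (g ∷ β)) γ
    ≡⟨ cong₂ _+_ (sym (Σ₊-weight-lower w g (λ a c → egf ω (shift F a c) γ)))
                 (trans (timesV-Σ₊ g (weight w) (λ a c → egf ω (shift F a c)) γ)
                        (Σ₊-cong g (λ a c → cong (weight w a c *_) (egf-timesV ω (shift F a c) γ)))) ⟩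
  Σ₊ g lower + Σ₊ g main
    ≡⟨ ℚ.+-comm (Σ₊ g lower) (Σ₊ g main) ⟩
  Σ₊ g main + Σ₊ g lower
    ≡⟨ Σ₊-+ g main lower ⟨
  Σ₊ g (λ a c → main a c + lower a c)
    ≡⟨ Σ₊-cong g (λ a c → ℚ.*-distribˡ-+ (weight w a c) _ _) ⟨
  Σ₊ g (λ a c → weight w a c * (egf ω (timesVᵉ (shift F a c)) γ + ℕ→ℚ c * egf ω (shift F a (c ∸ 1)) γ))
    ≡⟨ Σ₊-cong g (λ a c → cong (weight w a c *_) (egf-shift-timesVᵉ ω F a c γ)) ⟨
  egf (w ∷ ω) (timesVᵉ F) (g ∷ γ) ∎
  where
  cons : ℕ × Vec ℕ _ → ℕ × Vec ℕ _
  cons t = (proj₁ t , g ∷ proj₂ t)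
  main lower : ℕ → ℕ → ℚ
  main  a c = weight w a c * egf ω (timesVᵉ (shift F a c)) γ
  lower a c = weight w a c * (ℕ→ℚ c * egf ω (shift F a (c ∸ 1)) γ)

kronecker : ℕ → ℕ → ℚ
kronecker zero    zero    = 1ℚ
kronecker zero    (suc _) = 0ℚ
kronecker (suc _) zero    = 0ℚ
kronecker (suc a) (suc b) = kronecker a b

kronecker-refl : ∀ a → kronecker a a ≡ 1ℚ
kronecker-refl zero    = refl
kronecker-refl (suc a) = kronecker-refl a

kronecker-≢ : ∀ {a b} → a ≢ b → kronecker a b ≡ 0ℚ
kronecker-≢ {zero}  {zero}  a≢b = contradiction refl a≢b
kronecker-≢ {zero}  {suc b} a≢b = refl
kronecker-≢ {suc a} {zero}  a≢b = refl
kronecker-≢ {suc a} {suc b} a≢b = kronecker-≢ (a≢b ∘ cong suc)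

kronecker-*-subst : ∀ a b (f : ℕ → ℚ) → kronecker a b * f a ≡ kronecker a b * f b
kronecker-*-subst zero    zero    f = refl
kronecker-*-subst zero    (suc b) f = trans (ℚ.*-zeroˡ (f 0)) (sym (ℚ.*-zeroˡ (f (suc b))))
kronecker-*-subst (suc a) zero    f = trans (ℚ.*-zeroˡ (f (suc a))) (sym (ℚ.*-zeroˡ (f 0)))
kronecker-*-subst (suc a) (suc b) f = kronecker-*-subst a b (f ∘ suc)

-- egf ω (Dcoeff j) is v^j e^u, the image of e^(ω₁t₁ + ⋯ + ω_kt_k) under D_j.
Dcoeff : ℕ → ℕ → ℕ → ℚ
Dcoeff j b c = kronecker c j * ℕ→ℚ (j !)

timesVᵉ-Dcoeff : ∀ j b c → timesVᵉ (Dcoeff j) b c ≡ Dcoeff (suc j) b c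
timesVᵉ-Dcoeff j b zero    = trans (ℚ.*-zeroˡ (Dcoeff j b 0)) (sym (ℚ.*-zeroˡ (ℕ→ℚ (suc j !))))
timesVᵉ-Dcoeff j b (suc c) = begin
  ℕ→ℚ (suc c) * (kronecker c j * ℕ→ℚ (j !))     ≡⟨ ℚ*.x∙yz≈yx∙z (ℕ→ℚ (suc c)) (kronecker c j) (ℕ→ℚ (j !)) ⟩
  (kronecker c j * ℕ→ℚ (suc c)) * ℕ→ℚ (j !)     ≡⟨ cong (_* ℕ→ℚ (j !)) (kronecker-*-subst c j (ℕ→ℚ ∘ suc)) ⟩
  (kronecker c j * ℕ→ℚ (suc j)) * ℕ→ℚ (j !)     ≡⟨ ℚ.*-assoc (kronecker c j) (ℕ→ℚ (suc j)) (ℕ→ℚ (j !)) ⟩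
  kronecker c j * (ℕ→ℚ (suc j) * ℕ→ℚ (j !))     ≡⟨ cong (kronecker c j *_) (ℕ→ℚ-* (suc j) (j !)) ⟨
  kronecker c j * ℕ→ℚ (suc j !)                  ∎

egf-Dcoeff-zero : ∀ {k} (ω : Vec ℚ k) α → egf ω (Dcoeff 0) α ≡ invFactProd α * evalMono ω α
egf-Dcoeff-zero []      []      = refl
egf-Dcoeff-zero (w ∷ ω) (g ∷ γ) = begin
  Σ₊ g (λ a c → weight w a c * egf ω (shift (Dcoeff 0) a c) γ)
    ≡⟨ Σ₊-last g _ (λ a c → trans (cong (weight w a (suc c) *_) (egf-zero ω _ γ (λ _ _ → ℚ.*-zeroˡ 1ℚ)))
                                  (ℚ.*-zeroʳ (weight w a (suc c)))) ⟩
  weight w g 0 * egf ω (Dcoeff 0) γ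
    ≡⟨ cong (weight w g 0 *_) (egf-Dcoeff-zero ω γ) ⟩
  ((w ^ℚ g) * (invFact g * 1ℚ)) * (invFactProd γ * evalMono ω γ)
    ≡⟨ regroup (invFact g) (invFactProd γ) (w ^ℚ g) (evalMono ω γ) ⟩
  (invFact g * invFactProd γ) * ((w ^ℚ g) * evalMono ω γ)
    ≡⟨ cong (_* ((w ^ℚ g) * evalMono ω γ)) (invFactProd-∷ g γ) ⟨
  invFactProd (g ∷ γ) * evalMono (w ∷ ω) (g ∷ γ) ∎
  where
  regroup : ∀ i f p e → (p * (i * 1ℚ)) * (f * e) ≡ (i * f) * (p * e)
  regroup = solve-∀ ℚ-ring

egf-D : ∀ {k} (ω : Vec ℚ k) j α → invFactProd α * evalD ω j α ≡ egf ω (Dcoeff j) α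
egf-D ω zero    α = begin
  invFactProd α * (1ℚ * evalMono ω α + 0ℚ)   ≡⟨ cong (invFactProd α *_) (trans (ℚ.+-identityʳ _) (ℚ.*-identityˡ _)) ⟩
  invFactProd α * evalMono ω α               ≡⟨ egf-Dcoeff-zero ω α ⟨
  egf ω (Dcoeff 0) α                         ∎
egf-D ω (suc j) α = begin
  invFactProd α * evalD ω (suc j) α
    ≡⟨ cong (invFactProd α *_) (evalD-suc ω j α) ⟩
  invFactProd α * sumℚ (map (λ t → ℕ→ℚ (proj₁ t) * evalD ω j (proj₂ t)) (partials α))
    ≡⟨ invFactProd-*-partials α (evalD ω j) ⟩
  timesV (λ β → invFactProd β * evalD ω j β) α
    ≡⟨ sumℚ-map-cong (partials α) (λ t → cong (sgn (proj₁ t) *_) (egf-D ω j (proj₂ t))) ⟩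
  timesV (egf ω (Dcoeff j)) α
    ≡⟨ egf-timesV ω (Dcoeff j) α ⟩
  egf ω (timesVᵉ (Dcoeff j)) α
    ≡⟨ egf-cong ω α (timesVᵉ-Dcoeff j) ⟩
  egf ω (Dcoeff (suc j)) α ∎

falling : ℚ → ℕ → ℚ
falling = pochhammer (- 1ℚ)

rising : ℚ → ℕ → ℚ
rising = pochhammer 1ℚ

falling-applyUpTo : ∀ n x (f : ℕ → ℚ) → (∀ m → f m ≡ x - ℕ→ℚ m) → prodℚ (applyUpTo f n) ≡ falling x n
falling-applyUpTo zero    x f f≡ = refl
falling-applyUpTo (suc n) x f f≡ =
  cong₂ _*_ (trans (f≡ 0) (minus-zero x))
            (falling-applyUpTo n (x + - 1ℚ) (f ∘ suc)
              (λ m → trans (f≡ (suc m)) (trans (cong (_-_ x) (ℕ→ℚ-suc m)) (minus-suc x (ℕ→ℚ m)))))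
  where
  minus-zero : ∀ x → x - 0ℚ ≡ x
  minus-zero = solve-∀ ℚ-ring
  minus-suc : ∀ x y → x - (1ℚ + y) ≡ (x + - 1ℚ) - y
  minus-suc = solve-∀ ℚ-ring

B≡falling : ∀ q j → B q j ≡ falling q (suc j)
B≡falling q j = trans (cong prodℚ (List.map-upTo (λ m → q - ℕ→ℚ m) (suc j))) (falling-applyUpTo (suc j) q _ (λ _ → refl))

risingℕ : ℕ → ℕ → ℕ
risingℕ n zero    = 1
risingℕ n (suc m) = n ℕ.* risingℕ (suc n) m

rising-ℕ→ℚ : ∀ n m → rising (ℕ→ℚ n) m ≡ ℕ→ℚ (risingℕ n m)
rising-ℕ→ℚ n zero    = refl
rising-ℕ→ℚ n (suc m) = begin
  ℕ→ℚ n * rising (ℕ→ℚ n + 1ℚ) m         ≡⟨ cong (λ z → ℕ→ℚ n * rising z m) (trans (ℚ.+-comm (ℕ→ℚ n) 1ℚ) (sym (ℕ→ℚ-suc n))) ⟩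
  ℕ→ℚ n * rising (ℕ→ℚ (suc n)) m        ≡⟨ cong (ℕ→ℚ n *_) (rising-ℕ→ℚ (suc n) m) ⟩
  ℕ→ℚ n * ℕ→ℚ (risingℕ (suc n) m)       ≡⟨ ℕ→ℚ-* n (risingℕ (suc n) m) ⟨
  ℕ→ℚ (n ℕ.* risingℕ (suc n) m)         ∎

risingℕ-! : ∀ n m → risingℕ (suc n) m ℕ.* n ! ≡ (n ℕ.+ m) !
risingℕ-! n zero    = trans (ℕ.*-identityˡ (n !)) (cong _! (sym (ℕ.+-identityʳ n)))
risingℕ-! n (suc m) = begin
  (suc n ℕ.* risingℕ (suc (suc n)) m) ℕ.* n !   ≡⟨ ℕ*.xy∙z≈y∙xz (suc n) (risingℕ (suc (suc n)) m) (n !) ⟩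
  risingℕ (suc (suc n)) m ℕ.* (suc n ℕ.* n !)   ≡⟨ risingℕ-! (suc n) m ⟩
  (suc n ℕ.+ m) !                               ≡⟨ cong _! (ℕ.+-suc n m) ⟨
  (n ℕ.+ suc m) !                               ∎

C-*-!≡risingℕ : ∀ b m → ((b ℕ.+ m) C b) ℕ.* m ! ≡ risingℕ (suc b) m
C-*-!≡risingℕ b m = ℕ.*-cancelʳ-≡ _ _ (b !) {{b ℕ.!≢0}} (begin
  (((b ℕ.+ m) C b) ℕ.* m !) ℕ.* b !   ≡⟨ cong (λ z → (z ℕ.* m !) ℕ.* b !) (C≡binom b m) ⟩
  (binom b m ℕ.* m !) ℕ.* b !         ≡⟨ ℕ*.xy∙z≈x∙zy (binom b m) (m !) (b !) ⟩
  binom b m ℕ.* (b ! ℕ.* m !)         ≡⟨ binom-! b m ⟩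
  (b ℕ.+ m) !                         ≡⟨ risingℕ-! b m ⟨
  risingℕ (suc b) m ℕ.* b !           ∎)

-- egf ω (Hcoeff q) is (1 + u/(1 - v))^q = Σ_b (q choose b) u^b (1 - v)^(-b).
Hcoeff : ℚ → ℕ → ℕ → ℚ
Hcoeff q b m = falling q b * rising (ℕ→ℚ b) m

Σ₊-Dcoeff≡Hcoeff : ∀ q n b m → b ℕ.+ m ≡ suc n →
                    Σ₊ n (λ j i → (ℕ→ℚ (n C j) * B q j) * Dcoeff i b m) ≡ Hcoeff q b m
Σ₊-Dcoeff≡Hcoeff q n zero    .(suc n) refl = begin
  Σ₊ n (λ j i → (ℕ→ℚ (n C j) * B q j) * Dcoeff i 0 (suc n))
    ≡⟨ Σ₊-zero n (λ j i j+i≡n → vanish j i (λ i≡ → ℕ.m≢1+n+m i (trans i≡ (cong suc (sym j+i≡n))))) ⟩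
  0ℚ
    ≡⟨ trans (ℚ.*-identityˡ _) (ℚ.*-zeroˡ (rising 1ℚ n)) ⟨
  Hcoeff q 0 (suc n) ∎
  where
  vanish : ∀ j i → i ≢ suc n → (ℕ→ℚ (n C j) * B q j) * Dcoeff i 0 (suc n) ≡ 0ℚ
  vanish j i i≢ = trans (cong (λ z → (ℕ→ℚ (n C j) * B q j) * (z * ℕ→ℚ (i !))) (kronecker-≢ (i≢ ∘ sym)))
                        (trans (cong ((ℕ→ℚ (n C j) * B q j) *_) (ℚ.*-zeroˡ (ℕ→ℚ (i !)))) (ℚ.*-zeroʳ (ℕ→ℚ (n C j) * B q j)))
Σ₊-Dcoeff≡Hcoeff q .(b ℕ.+ m) (suc b) m refl = begin
  Σ₊ (b ℕ.+ m) (λ j i → c j * Dcoeff i (suc b) m)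
    ≡⟨ Σ₊-single b m _ (λ j i _ i≢m → vanish j i i≢m) ⟩
  c b * (kronecker m m * ℕ→ℚ (m !))
    ≡⟨ cong (λ z → c b * (z * ℕ→ℚ (m !))) (kronecker-refl m) ⟩
  (ℕ→ℚ ((b ℕ.+ m) C b) * B q b) * (1ℚ * ℕ→ℚ (m !))
    ≡⟨ cong (c b *_) (ℚ.*-identityˡ (ℕ→ℚ (m !))) ⟩
  (ℕ→ℚ ((b ℕ.+ m) C b) * B q b) * ℕ→ℚ (m !)
    ≡⟨ ℚ*.xy∙z≈y∙xz (ℕ→ℚ ((b ℕ.+ m) C b)) (B q b) (ℕ→ℚ (m !)) ⟩
  B q b * (ℕ→ℚ ((b ℕ.+ m) C b) * ℕ→ℚ (m !))
    ≡⟨ cong₂ _*_ (B≡falling q b) (trans (sym (ℕ→ℚ-* ((b ℕ.+ m) C b) (m !)))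
                                        (trans (cong ℕ→ℚ (C-*-!≡risingℕ b m)) (sym (rising-ℕ→ℚ (suc b) m)))) ⟩
  Hcoeff q (suc b) m ∎
  where
  c : ℕ → ℚ
  c j = ℕ→ℚ ((b ℕ.+ m) C j) * B q j
  vanish : ∀ j i → i ≢ m → c j * Dcoeff i (suc b) m ≡ 0ℚ
  vanish j i i≢ = trans (cong (λ z → c j * (z * ℕ→ℚ (i !))) (kronecker-≢ (i≢ ∘ sym)))
                        (trans (cong (c j *_) (ℚ.*-zeroˡ (ℕ→ℚ (i !)))) (ℚ.*-zeroʳ (c j)))

size≡suc : ∀ {k} (α : Vec ℕ k) → isZero α ≡ false → ∃[ n ] size α ≡ suc n
size≡suc (zero  ∷ α) α≢0 = size≡suc α α≢0
size≡suc (suc a ∷ α) _   = a ℕ.+ size α , refl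

Hterm-egf : ∀ {k} (ω : Vec ℚ k) q α n → size α ≡ suc n → Hterm ω q α ≡ egf ω (Hcoeff q) α
Hterm-egf ω q α n size≡ = begin
  Hterm ω q α
    ≡⟨ cong terms size≡ ⟩
  sumℚ (map (λ j → ((invFactProd α * ℕ→ℚ (n C j)) * B q j) * evalD ω (suc n ∸ j ∸ 1) α) (upTo (suc n)))
    ≡⟨ sumℚ-map-cong (upTo (suc n)) term-egf ⟩
  sumℚ (map (λ j → egf ω (λ b m → c j * Dcoeff (n ∸ j) b m) α) (upTo (suc n)))
    ≡⟨ egf-sumℚ ω (λ j b m → c j * Dcoeff (n ∸ j) b m) (upTo (suc n)) α ⟨
  egf ω (λ b m → sumℚ (map (λ j → c j * Dcoeff (n ∸ j) b m) (upTo (suc n)))) α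
    ≡⟨ egf-cong-on ω α (λ b m b+m≡ → trans (sumℚ-upTo-Σ₊ n (λ j i → c j * Dcoeff i b m))
                                           (Σ₊-Dcoeff≡Hcoeff q n b m (trans b+m≡ size≡))) ⟩
  egf ω (Hcoeff q) α ∎
  where
  terms : ℕ → ℚ
  terms s = sumℚ (map (λ j → invFactProd α * ℕ→ℚ ((s ∸ 1) C j) * B q j * evalD ω (s ∸ j ∸ 1) α) (upTo s))
  c : ℕ → ℚ
  c j = ℕ→ℚ (n C j) * B q j
  regroup : ∀ i c b e → ((i * c) * b) * e ≡ (c * b) * (i * e)
  regroup = solve-∀ ℚ-ring
  term-egf : ∀ j → ((invFactProd α * ℕ→ℚ (n C j)) * B q j) * evalD ω (suc n ∸ j ∸ 1) α ≡
                   egf ω (λ b m → c j * Dcoeff (n ∸ j) b m) α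
  term-egf j = begin
    ((invFactProd α * ℕ→ℚ (n C j)) * B q j) * evalD ω (suc n ∸ j ∸ 1) α
      ≡⟨ regroup (invFactProd α) (ℕ→ℚ (n C j)) (B q j) _ ⟩
    c j * (invFactProd α * evalD ω (suc n ∸ j ∸ 1) α)
      ≡⟨ cong (c j *_) (egf-D ω (suc n ∸ j ∸ 1) α) ⟩
    c j * egf ω (Dcoeff (suc n ∸ j ∸ 1)) α
      ≡⟨ cong (λ i → c j * egf ω (Dcoeff i) α) (trans (ℕ.∸-+-assoc (suc n) j 1) (cong (suc n ∸_) (ℕ.+-comm j 1))) ⟩
    c j * egf ω (Dcoeff (n ∸ j)) α
      ≡⟨ egf-*ˡ ω (c j) (Dcoeff (n ∸ j)) α ⟨
    egf ω (λ b m → c j * Dcoeff (n ∸ j) b m) α ∎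

-- Hseries ω q α is the coefficient of t^α in Σ_n H_{k,n,ω}(t,q).
Hseries : ∀ {k} → Vec ℚ k → ℚ → Poly k
Hseries ω q α = if isZero α then 1ℚ else Hterm ω q α

Hseries-egf : ∀ {k} (ω : Vec ℚ k) q α → Hseries ω q α ≡ egf ω (Hcoeff q) α
Hseries-egf ω q α with isZero α in α≟0
... | true  = sym (egf-isZero ω (Hcoeff q) α α≟0)
... | false = let (n , size≡) = size≡suc α α≟0 in Hterm-egf ω q α n size≡

Hcoeff-⊛-inverse : ∀ q b m → (Hcoeff q ⊛ Hcoeff (- q)) b m ≡ δ b m
Hcoeff-⊛-inverse q b m = begin
  Σbin b (λ b₁ b₂ → Σbin m (λ m₁ m₂ → (falling q b₁ * rising (ℕ→ℚ b₁) m₁) * (falling (- q) b₂ * rising (ℕ→ℚ b₂) m₂)))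
    ≡⟨ Σbin-cong b inner ⟩
  Σbin b (λ b₁ b₂ → (falling q b₁ * falling (- q) b₂) * rising (ℕ→ℚ (b₁ ℕ.+ b₂)) m)
    ≡⟨ Σbin-cong-on b (λ b₁ b₂ b₁+b₂≡b → cong (λ z → (falling q b₁ * falling (- q) b₂) * rising (ℕ→ℚ z) m) b₁+b₂≡b) ⟩
  Σbin b (λ b₁ b₂ → (falling q b₁ * falling (- q) b₂) * rising (ℕ→ℚ b) m)
    ≡⟨ Σbin-*ʳ b (rising (ℕ→ℚ b) m) (λ b₁ b₂ → falling q b₁ * falling (- q) b₂) ⟩
  Σbin b (λ b₁ b₂ → falling q b₁ * falling (- q) b₂) * rising (ℕ→ℚ b) m
    ≡⟨ cong (_* rising (ℕ→ℚ b) m) (pochhammer-vandermonde (- 1ℚ) b q (- q)) ⟨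
  falling (q + - q) b * rising (ℕ→ℚ b) m
    ≡⟨ cong (λ z → falling z b * rising (ℕ→ℚ b) m) (ℚ.+-inverseʳ q) ⟩
  Hcoeff 0ℚ b m
    ≡⟨ Hcoeff-zero b m ⟩
  δ b m ∎
  where
  inner : ∀ b₁ b₂ → Σbin m (λ m₁ m₂ → (falling q b₁ * rising (ℕ→ℚ b₁) m₁) * (falling (- q) b₂ * rising (ℕ→ℚ b₂) m₂)) ≡
                    (falling q b₁ * falling (- q) b₂) * rising (ℕ→ℚ (b₁ ℕ.+ b₂)) m
  inner b₁ b₂ = begin
    Σbin m (λ m₁ m₂ → (falling q b₁ * rising (ℕ→ℚ b₁) m₁) * (falling (- q) b₂ * rising (ℕ→ℚ b₂) m₂))
      ≡⟨ Σbin-cong m (λ m₁ m₂ → ℚ*.interchange (falling q b₁) _ (falling (- q) b₂) _) ⟩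
    Σbin m (λ m₁ m₂ → (falling q b₁ * falling (- q) b₂) * (rising (ℕ→ℚ b₁) m₁ * rising (ℕ→ℚ b₂) m₂))
      ≡⟨ Σbin-*ˡ m (falling q b₁ * falling (- q) b₂) _ ⟩
    (falling q b₁ * falling (- q) b₂) * Σbin m (λ m₁ m₂ → rising (ℕ→ℚ b₁) m₁ * rising (ℕ→ℚ b₂) m₂)
      ≡⟨ cong ((falling q b₁ * falling (- q) b₂) *_) (pochhammer-vandermonde 1ℚ m (ℕ→ℚ b₁) (ℕ→ℚ b₂)) ⟨
    (falling q b₁ * falling (- q) b₂) * rising (ℕ→ℚ b₁ + ℕ→ℚ b₂) m
      ≡⟨ cong (λ z → (falling q b₁ * falling (- q) b₂) * rising z m) (ℕ→ℚ-+ b₁ b₂) ⟨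
    (falling q b₁ * falling (- q) b₂) * rising (ℕ→ℚ (b₁ ℕ.+ b₂)) m ∎
  Hcoeff-zero : ∀ b m → Hcoeff 0ℚ b m ≡ δ b m
  Hcoeff-zero zero    zero    = refl
  Hcoeff-zero zero    (suc m) = trans (ℚ.*-identityˡ _) (ℚ.*-zeroˡ (rising (0ℚ + 1ℚ) m))
  Hcoeff-zero (suc b) m       = trans (cong (_* rising (ℕ→ℚ (suc b)) m) (ℚ.*-zeroˡ (falling (0ℚ + - 1ℚ) b)))
                                      (ℚ.*-zeroˡ (rising (ℕ→ℚ (suc b)) m))

Hseries-inverse : ∀ {k} (ω : Vec ℚ k) q γ → (Hseries ω q *P Hseries ω (- q)) γ ≡ oneP γ
Hseries-inverse ω q γ = begin
  (Hseries ω q *P Hseries ω (- q)) γ               ≡⟨ *P-cong γ (Hseries-egf ω q) (Hseries-egf ω (- q)) ⟩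
  (egf ω (Hcoeff q) *P egf ω (Hcoeff (- q))) γ     ≡⟨ egf-*P ω (Hcoeff q) (Hcoeff (- q)) γ ⟩
  egf ω (Hcoeff q ⊛ Hcoeff (- q)) γ                ≡⟨ egf-cong ω γ (Hcoeff-⊛-inverse q) ⟩
  egf ω δ γ                                        ≡⟨ egf-δ ω γ ⟩
  oneP γ                                           ∎

wdeg′-isZero : ∀ {k} i (β : Vec ℕ k) → isZero β ≡ true → wdeg′ i β ≡ 0
wdeg′-isZero i []          _   = refl
wdeg′-isZero i (zero ∷ β)  β≟0 = trans (cong (ℕ._+ wdeg′ (suc i) β) (ℕ.*-zeroʳ i)) (wdeg′-isZero (suc i) β β≟0)

wdeg′-¬isZero : ∀ {k} i (β : Vec ℕ k) → isZero β ≡ false → wdeg′ (suc i) β ≢ 0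
wdeg′-¬isZero i (zero  ∷ β) β≟0 wdeg≡0 =
  wdeg′-¬isZero (suc i) β β≟0 (trans (sym (cong (ℕ._+ wdeg′ (suc (suc i)) β) (ℕ.*-zeroʳ (suc i)))) wdeg≡0)
wdeg′-¬isZero i (suc a ∷ β) β≟0 ()

H-graded : ∀ k (ω : Vec ℚ k) q i β → H k ω q i β ≡ kronecker (wdeg β) i * Hseries ω q β
H-graded k ω q zero β with isZero β in β≟0
... | true  rewrite wdeg′-isZero 1 β β≟0 = refl
... | false = sym (trans (cong (_* Hterm ω q β) (kronecker-≢ (wdeg′-¬isZero 0 β β≟0))) (ℚ.*-zeroˡ (Hterm ω q β)))
H-graded k ω q (suc n) β with wdeg β ℕ.≟ suc n
... | no  wdeg≢ = sym (trans (cong (_* Hseries ω q β) (kronecker-≢ wdeg≢)) (ℚ.*-zeroˡ (Hseries ω q β)))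
... | yes wdeg≡ = sym (begin
  kronecker (wdeg β) (suc n) * Hseries ω q β   ≡⟨ cong (λ d → kronecker d (suc n) * Hseries ω q β) wdeg≡ ⟩
  kronecker (suc n) (suc n) * Hseries ω q β    ≡⟨ cong (_* Hseries ω q β) (kronecker-refl n) ⟩
  1ℚ * Hseries ω q β                           ≡⟨ ℚ.*-identityˡ (Hseries ω q β) ⟩
  Hseries ω q β                                ≡⟨ Hseries-nonzero ⟩
  Hterm ω q β                                  ∎)
  where
  Hseries-nonzero : Hseries ω q β ≡ Hterm ω q β
  Hseries-nonzero with isZero β in β≟0
  ... | true  = contradiction (trans (sym (wdeg′-isZero 1 β β≟0)) wdeg≡) ℕ.0≢1+n
  ... | false = refl

Σ₊-kronecker : ∀ n x y c → Σ₊ n (λ i j → (kronecker x i * kronecker y j) * c) ≡ kronecker (x ℕ.+ y) n * c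
Σ₊-kronecker zero    zero    zero    c = refl
Σ₊-kronecker zero    zero    (suc y) c = refl
Σ₊-kronecker zero    (suc x) y       c = cong (_* c) (ℚ.*-zeroˡ (kronecker y 0))
Σ₊-kronecker (suc n) zero    y       c = begin
  (1ℚ * kronecker y (suc n)) * c + Σ₊ n (λ i j → (0ℚ * kronecker y j) * c)
    ≡⟨ cong₂ _+_ (cong (_* c) (ℚ.*-identityˡ (kronecker y (suc n))))
                 (Σ₊-zero n (λ i j _ → trans (cong (_* c) (ℚ.*-zeroˡ (kronecker y j))) (ℚ.*-zeroˡ c))) ⟩
  kronecker y (suc n) * c + 0ℚ
    ≡⟨ ℚ.+-identityʳ (kronecker y (suc n) * c) ⟩
  kronecker y (suc n) * c ∎
Σ₊-kronecker (suc n) (suc x) y       c = begin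
  (0ℚ * kronecker y (suc n)) * c + Σ₊ n (λ i j → (kronecker x i * kronecker y j) * c)
    ≡⟨ cong₂ _+_ (trans (cong (_* c) (ℚ.*-zeroˡ (kronecker y (suc n)))) (ℚ.*-zeroˡ c)) (Σ₊-kronecker n x y c) ⟩
  0ℚ + kronecker (x ℕ.+ y) n * c
    ≡⟨ ℚ.+-identityˡ (kronecker (x ℕ.+ y) n * c) ⟩
  kronecker (x ℕ.+ y) n * c ∎

splits-wdeg′ : ∀ {k} i (γ : Vec ℕ k) → All (λ p → wdeg′ i (proj₁ p) ℕ.+ wdeg′ i (proj₂ p) ≡ wdeg′ i γ) (splits γ)
splits-wdeg′ i []      = refl ∷ []
splits-wdeg′ i (g ∷ γ) = All.concat⁺ (All.map⁺ (All.applyUpTo⁺₁ id (suc g) (λ {a} a<1+g →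
  All.map⁺ (All.map (λ {p} wdeg≡ → head-tail a (ℕ.≤-pred a<1+g) (proj₁ p) (proj₂ p) wdeg≡) (splits-wdeg′ (suc i) γ)))))
  where
  distrib : ∀ i a b x y → (i ℕ.* a ℕ.+ x) ℕ.+ (i ℕ.* b ℕ.+ y) ≡ i ℕ.* (a ℕ.+ b) ℕ.+ (x ℕ.+ y)
  distrib = ℕ-Solver.solve-∀
  head-tail : ∀ a → a ℕ.≤ g → ∀ α β → wdeg′ (suc i) α ℕ.+ wdeg′ (suc i) β ≡ wdeg′ (suc i) γ →
              (i ℕ.* a ℕ.+ wdeg′ (suc i) α) ℕ.+ (i ℕ.* (g ∸ a) ℕ.+ wdeg′ (suc i) β) ≡ i ℕ.* g ℕ.+ wdeg′ (suc i) γ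
  head-tail a a≤g α β wdeg≡ = trans (distrib i a (g ∸ a) (wdeg′ (suc i) α) (wdeg′ (suc i) β))
                                    (cong₂ (λ u v → i ℕ.* u ℕ.+ v) (ℕ.m+[n∸m]≡n a≤g) wdeg≡)

levelProd-graded : ∀ {k} {P Q : ℕ → Poly k} {f g : Poly k} →
                   (∀ i β → P i β ≡ kronecker (wdeg β) i * f β) → (∀ j β → Q j β ≡ kronecker (wdeg β) j * g β) →
                   ∀ n γ → levelProd P Q n γ ≡ kronecker (wdeg γ) n * (f *P g) γ
levelProd-graded {P = P} {Q} {f} {g} P≡ Q≡ n γ = begin
  sumP (map (λ i → P i *P Q (n ∸ i)) (upTo (suc n))) γ
    ≡⟨ sumP-apply (λ i → P i *P Q (n ∸ i)) (upTo (suc n)) γ ⟩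
  sumℚ (map (λ i → (P i *P Q (n ∸ i)) γ) (upTo (suc n)))
    ≡⟨ sumℚ-upTo-Σ₊ n (λ i j → (P i *P Q j) γ) ⟩
  Σ₊ n (λ i j → (P i *P Q j) γ)
    ≡⟨ Σ₊-cong n (λ i j → sumℚ-map-cong (splits γ) (λ p →
         trans (cong₂ _*_ (P≡ i (proj₁ p)) (Q≡ j (proj₂ p)))
               (ℚ*.interchange (kronecker (wdeg (proj₁ p)) i) (f (proj₁ p)) (kronecker (wdeg (proj₂ p)) j) (g (proj₂ p))))) ⟩
  Σ₊ n (λ i j → sumℚ (map (λ p → (kronecker (wdeg (proj₁ p)) i * kronecker (wdeg (proj₂ p)) j) * fg p) (splits γ)))
    ≡⟨ sumℚ-Σ₊ n (λ i j p → (kronecker (wdeg (proj₁ p)) i * kronecker (wdeg (proj₂ p)) j) * fg p) (splits γ) ⟨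
  sumℚ (map (λ p → Σ₊ n (λ i j → (kronecker (wdeg (proj₁ p)) i * kronecker (wdeg (proj₂ p)) j) * fg p)) (splits γ))
    ≡⟨ sumℚ-map-cong (splits γ) (λ p → Σ₊-kronecker n (wdeg (proj₁ p)) (wdeg (proj₂ p)) (fg p)) ⟩
  sumℚ (map (λ p → kronecker (wdeg (proj₁ p) ℕ.+ wdeg (proj₂ p)) n * fg p) (splits γ))
    ≡⟨ cong sumℚ (List.map-cong-local (All.map (λ {p} wdeg≡ → cong (λ d → kronecker d n * fg p) wdeg≡) (splits-wdeg′ 1 γ))) ⟩
  sumℚ (map (λ p → kronecker (wdeg γ) n * fg p) (splits γ))
    ≡⟨ sumℚ-*ˡ (kronecker (wdeg γ) n) fg (splits γ) ⟩
  kronecker (wdeg γ) n * (f *P g) γ ∎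
  where
  fg : Vec ℕ _ × Vec ℕ _ → ℚ
  fg p = f (proj₁ p) * g (proj₂ p)

kronecker-*-oneP : ∀ {k} n (γ : Vec ℕ k) → kronecker (wdeg γ) n * oneP γ ≡ levelUnit n γ
kronecker-*-oneP zero γ with isZero γ in γ≟0
... | true  rewrite wdeg′-isZero 1 γ γ≟0 = refl
... | false = ℚ.*-zeroʳ (kronecker (wdeg γ) 0)
kronecker-*-oneP (suc n) γ with isZero γ in γ≟0
... | true  rewrite wdeg′-isZero 1 γ γ≟0 = refl
... | false = ℚ.*-zeroʳ (kronecker (wdeg γ) (suc n))

theorem13 : (k : ℕ) → 1 ≤ k → (ω : Vec ℚ k) → (q : ℚ) → (n : ℕ) →
    (γ : Vec ℕ k) →
    levelProd (H k ω q) (H k ω (- q)) n γ ≡ levelUnit n γ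
-- The argument works for every k.
theorem13 k _ ω q n γ = begin
  levelProd (H k ω q) (H k ω (- q)) n γ
    ≡⟨ levelProd-graded (H-graded k ω q) (H-graded k ω (- q)) n γ ⟩
  kronecker (wdeg γ) n * (Hseries ω q *P Hseries ω (- q)) γ
    ≡⟨ cong (kronecker (wdeg γ) n *_) (Hseries-inverse ω q γ) ⟩
  kronecker (wdeg γ) n * oneP γ
    ≡⟨ kronecker-*-oneP n γ ⟩
  levelUnit n γ ∎
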